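{- Let $q\ge2$, $n\ge0$ be integers, let $G=(g_{ij})_{i,j=0}^{q-1}$ be a $q\times q$ generalized Hadamard matrix, and let $\gamma$ be a polynomial evaluated at $x=(x_0,\ldots,x_{q-1})\in V(n,q)$. (1) Suppose $G$ is symmetric. If $\gamma(x)=\sum_{s\in V(n,q)}\alpha_s\,MG(x;s)$ for all $x\in V(n,q)$ with coefficients $\alpha_s\in\mathbb{C}$, then for all $\ell\in V(n,q)$, \[ \alpha_\ell=q^{ -n}\sum_{i\in V(n,q)}\gamma(i)\,\overline{MG(\ell;i)}. \] If $\gamma(x)=\sum_{s\in V(n,q)}\beta_s\,MG(s;x)$ for all $x\in V(n,q)$ with coefficients $\beta_s\in\mathbb{C}$, then for all $\ell\in V(n,q)$, \[ \beta_\ell=q^{ -n}\sum_{i\in V(n,q)}\gamma(i)\,\overline{MG(i;\ell)}. \] (2) Suppose instead that the core of $G$ is symmetric, $g_{0,j}=1$ for $j=0,\ldots,q-1$ and $g_{i,0}=-1$ for $i=1,\ldots,q-1$. Then, with the expansions as in (1), for all $\ell\in V(n,q)$, \[ \alpha_\ell=(-1)^{\ell_0}q^{ -n}\sum_{i\in V(n,q)}(-1)^{i_0}\gamma(i)\,\overline{MG(\ell;i)},\qquad \beta_\ell=(-1)^{\ell_0}q^{ -n}\sum_{i\in V(n,q)}(-1)^{i_0}\gamma(i)\,\overline{MG(i;\ell)}. \]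
   Context: A $q\times q$ complex matrix $H$ is a generalized Hadamard matrix if $H\overline{H}^T=qI_q$. The core of $G$ is the matrix $(g_{ij})_{i,j=1}^{q-1}$ obtained by deleting the first row and first column. For integers $n\ge0$, $q\ge2$, $V(n,q)=\{p=(p_0,\ldots,p_{q-1})\in\mathbb{N}_0^q : \sum_i p_i=n\}$, and $p!=\prod_{i}p_i!$. For $p,s\in V(n,q)$, \[ MG(p;s)=s!\sum_{(r_{i,j})}\prod_{a=0}^{q-1}\prod_{b=0}^{q-1}\frac{g_{ab}^{r_{a,b}}}{r_{a,b}!}, \] the sum being over all families of nonnegative integers $r_{i,j}$ ($i,j=0,\ldots,q-1$) with $\sum_j r_{i,j}=s_i$ for all $i$ and $\sum_i r_{i,j}=p_j$ for all $j$ (with $0^0=1$). -}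

module Defs where

open import Level using (Level; _⊔_) renaming (suc to lsuc)
open import Algebra.Bundles using (CommutativeRing)
open import Data.Nat using (ℕ; zero; suc; _∸_; _≤_; _!; _/_; NonZero; z≤n; s≤s; _≟_) renaming (_+_ to _+ℕ_; _*_ to _*ℕ_)
open import Data.Nat.Properties using (m*n≢0; _!≢0)
open import Data.Fin using (Fin)
import Data.Fin
import Data.Vec
open import Data.Vec using (Vec; []; _∷_; lookup; zipWith; replicate; toList; foldr)
open import Data.Vec.Properties using (≡-dec)
open import Data.List using (List; []; _∷_; [_]; map; concatMap; upTo; filter; concat)
open import Data.Bool using (if_then_else_)
open import Relation.Nullary.Decidable using (⌊_⌋)
open import Relation.Binary.PropositionalEquality using (_≡_; _≢_)

vsum : ∀ {k} → Vec ℕ k → ℕ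
vsum = foldr _ _+ℕ_ 0

-- the 0-th entry x_0 of a vector (0 for the empty vector; unused since q ≥ 2)
entry0 : ∀ {k} → Vec ℕ k → ℕ
entry0 []      = 0
entry0 (x ∷ _) = x

-- V(n,k) enumerated as a list: all vectors in ℕ^k with entry sum n
-- (each exactly once).
compositions : (n k : ℕ) → List (Vec ℕ k)
compositions zero    zero    = [ [] ]
compositions (suc n) zero    = []
compositions n       (suc k) =
  concatMap (λ i → map (i ∷_) (compositions (n ∸ i) k)) (upTo (suc n))

rowFamilies : ∀ {m} (q : ℕ) → Vec ℕ m → List (Vec (Vec ℕ q) m)
rowFamilies q []       = [ [] ]
rowFamilies q (s ∷ ss) =
  concatMap (λ row → map (row ∷_) (rowFamilies q ss)) (compositions s q)

colSums : ∀ {m q} → Vec (Vec ℕ q) m → Vec ℕ q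
colSums {q = q} = foldr _ (zipWith _+ℕ_) (replicate q 0)

families : ∀ {q} → Vec ℕ q → Vec ℕ q → List (Vec (Vec ℕ q) q)
families {q} p s =
  filter (λ r → ≡-dec _≟_ (colSums r) p) (rowFamilies q s)

factProd : List ℕ → ℕ
factProd []       = 1
factProd (x ∷ xs) = x ! *ℕ factProd xs

factProd≢0 : ∀ xs → NonZero (factProd xs)
factProd≢0 []       = _
factProd≢0 (x ∷ xs) = m*n≢0 (x !) (factProd xs) {{x !≢0}} {{factProd≢0 xs}}

vfact : ∀ {k} → Vec ℕ k → ℕ
vfact v = factProd (toList v)

famFact : ∀ {m q} → Vec (Vec ℕ q) m → ℕ
famFact r = factProd (concat (map toList (toList r)))

-- s! / ∏_{a,b} r_{a,b}!  (an integer when r has row sums s)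
famCoeff : ∀ {m q} → Vec ℕ m → Vec (Vec ℕ q) m → ℕ
famCoeff s r = (vfact s / famFact r) {{factProd≢0 (concat (map toList (toList r)))}}

-- Commutative rings with an involution ("complex conjugation")

record InvolutiveCommRing (c ℓ : Level) : Set (lsuc (c ⊔ ℓ)) where
  field
    commRing : CommutativeRing c ℓ
  open CommutativeRing commRing public hiding (ring)
  field
    conj       : Carrier → Carrier
    conj-cong  : ∀ {x y} → x ≈ y → conj x ≈ conj y
    conj-+     : ∀ x y → conj (x + y) ≈ conj x + conj y
    conj-*     : ∀ x y → conj (x * y) ≈ conj x * conj y
    conj-1     : conj 1# ≈ 1#
    conj-invol : ∀ x → conj (conj x) ≈ x

module WithRing {c ℓ} (K : InvolutiveCommRing c ℓ) where
  open InvolutiveCommRing K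

  ofℕ : ℕ → Carrier
  ofℕ zero    = 0#
  ofℕ (suc n) = 1# + ofℕ n

  pow : Carrier → ℕ → Carrier
  pow x zero    = 1#
  pow x (suc k) = x * pow x k

  Σl : ∀ {a} {A : Set a} → List A → (A → Carrier) → Carrier
  Σl []       f = 0#
  Σl (x ∷ xs) f = f x + Σl xs f

  Πl : ∀ {a} {A : Set a} → List A → (A → Carrier) → Carrier
  Πl []       f = 1#
  Πl (x ∷ xs) f = f x * Πl xs f

  Πv : ∀ {m} {A : Set} → Vec A m → (A → Carrier) → Carrier
  Πv v f = Πl (toList v) f

  ΣFin : (q : ℕ) → (Fin q → Carrier) → Carrier
  ΣFin zero    f = 0#
  ΣFin (suc q) f = f Fin.zero + ΣFin q (λ j → f (Fin.suc j))

  Matrix : ℕ → Set c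
  Matrix q = Fin q → Fin q → Carrier

  IsGenHadamard : ∀ {q} → Matrix q → Set ℓ
  IsGenHadamard {q} G = ∀ i j →
    ΣFin q (λ k → G i k * conj (G j k))
      ≈ (if ⌊ i Data.Fin.≟ j ⌋ then ofℕ q else 0#)

  IsSymmetric : ∀ {q} → Matrix q → Set ℓ
  IsSymmetric G = ∀ i j → G i j ≈ G j i

  monomial : ∀ {q} → Matrix q → Vec (Vec ℕ q) q → Carrier
  monomial {q} G r =
    Πl (toList (Data.Vec.allFin q)) λ a →
      Πl (toList (Data.Vec.allFin q)) λ b →
        pow (G a b) (lookup (lookup r a) b)

  -- MG(p;s) = s! Σ_r ∏_{a,b} g_{ab}^{r_{ab}} / r_{ab}!
  --         = Σ_r (s! / ∏ r_{ab}!) ∏ g_{ab}^{r_{ab}}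
  MG : ∀ {q} → Matrix q → Vec ℕ q → Vec ℕ q → Carrier
  MG G p s = Σl (families p s) λ r → ofℕ (famCoeff s r) * monomial G r

  ΣV : (n q : ℕ) → (Vec ℕ q → Carrier) → Carrier
  ΣV n q f = Σl (compositions n q) f

  sign : ℕ → Carrier
  sign k = pow (- 1#) k

  CoreSym : ∀ {q} → Matrix q → Set ℓ
  CoreSym G = ∀ i j → Data.Fin.toℕ i ≢ 0 → Data.Fin.toℕ j ≢ 0 → G i j ≈ G j i

  FirstRowOnes : ∀ {q} → Matrix q → Set ℓ
  FirstRowOnes G = ∀ i j → Data.Fin.toℕ i ≡ 0 → G i j ≈ 1#

  FirstColMinusOnes : ∀ {q} → Matrix q → Set ℓ
  FirstColMinusOnes G = ∀ i j → Data.Fin.toℕ i ≢ 0 → Data.Fin.toℕ j ≡ 0 → G i j ≈ - 1#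

module Submission where

-- MG_G(p;s) is the coefficient of X^p in ∏_a (Σ_b g_ab X_b)^{s_a}.  Writing it as
-- an iterated convolution of "row coefficients" (multinomial · monomial) and
-- using the Pascal recurrence for multinomials, we obtain the recurrence
-- MG_A(·; e_a + s) = (Σ_b a_ab X_b) · MG_A(·; s).  From it follow, by induction
-- on s, three structural facts:
--   * multiplicativity:  Σ_i MG_A(i;s) MG_B(l;i) = MG_{AB}(l;s),
--   * diagonal matrices: MG_{diag c}(l;s) = δ_{sl} χ(s) for a character χ of c,
--   * row scaling:       MG_{diag(d) B}(l;s) = ψ(s) MG_B(l;s).
-- Both parts of the theorem are instances of one statement about a
-- "d-twisted symmetric" Hadamard matrix, g_tj = d_t d_j g_jt for a real sign
-- vector d (d = 1 in part (1), d = (-1,1,…,1) in part (2)).  Then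
-- G · diag(d) Ḡ = q · diag(d), so the MG are orthogonal for the weight
-- ψ(s) = ∏ d_a^{s_a}, and an expansion γ = Σ_s α_s MG(·;s) is inverted by
-- pairing with ψ · conj MG.

open import Defs
open import Level using (Level)
open import Data.Nat using (ℕ; _≤_)
open import Data.Vec using (Vec)
open import Data.Product using (_×_)
open import Relation.Binary.PropositionalEquality using (_≡_)

open import Data.Nat using (zero; suc; _∸_; _!; _/_; _≟_; pred; s≤s; z≤n; _<_)
  renaming (_+_ to _+ℕ_; _*_ to _*ℕ_)
import Data.Nat.Properties as NP
open import Data.Nat.DivMod using (m*n/n≡m)
open import Data.Nat.Solver using (module +-*-Solver)
open import Data.Fin as F using (Fin)
open import Data.Vec as V using ([]; _∷_; lookup; zipWith; replicate; toList; tabulate; allFin)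
open import Data.Vec.Properties using (≡-dec)
open import Data.List using (List; []; _∷_; map; concatMap; upTo; applyUpTo; filter; concat; _++_)
open import Data.Bool using (if_then_else_)
open import Data.Empty using (⊥-elim)
open import Data.Unit using (⊤; tt)
open import Data.Product using (Σ; _,_; proj₁; proj₂)
open import Relation.Nullary using (Dec; yes; no; ¬_)
open import Relation.Nullary.Decidable using (⌊_⌋)
import Relation.Binary.PropositionalEquality as Eq
open Eq using (refl; cong; cong₂; subst; _≢_)
import Algebra.Solver.Ring.NaturalCoefficients.Default as RingSolver
import Algebra.Properties.Ring as RingProperties
open import Algebra.Bundles using (CommutativeRing)

_⊕_ : ∀ {k} → Vec ℕ k → Vec ℕ k → Vec ℕ k
_⊕_ = zipWith _+ℕ_

zeros : ∀ k → Vec ℕ k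
zeros k = replicate k 0

unit : ∀ {k} → Fin k → Vec ℕ k
unit {suc k} F.zero    = 1 ∷ zeros k
unit {suc k} (F.suc b) = 0 ∷ unit b

vsum-⊕ : ∀ {k} (u w : Vec ℕ k) → vsum (u ⊕ w) ≡ vsum u +ℕ vsum w
vsum-⊕ []      []      = refl
vsum-⊕ (x ∷ u) (y ∷ w) = Eq.trans (cong (x +ℕ y +ℕ_) (vsum-⊕ u w)) (swap-middle x y (vsum u) (vsum w))
  where
  open +-*-Solver
  swap-middle : ∀ a b c d → a +ℕ b +ℕ (c +ℕ d) ≡ a +ℕ c +ℕ (b +ℕ d)
  swap-middle = solve 4 (λ a b c d → a :+ b :+ (c :+ d) := a :+ c :+ (b :+ d)) refl

⊕-assoc : ∀ {k} (u v w : Vec ℕ k) → (u ⊕ v) ⊕ w ≡ u ⊕ (v ⊕ w)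
⊕-assoc []      []      []      = refl
⊕-assoc (x ∷ u) (y ∷ v) (z ∷ w) = cong₂ _∷_ (NP.+-assoc x y z) (⊕-assoc u v w)

⊕-comm : ∀ {k} (u v : Vec ℕ k) → u ⊕ v ≡ v ⊕ u
⊕-comm []      []      = refl
⊕-comm (x ∷ u) (y ∷ v) = cong₂ _∷_ (NP.+-comm x y) (⊕-comm u v)

zeros-⊕ : ∀ {k} (u : Vec ℕ k) → zeros k ⊕ u ≡ u
zeros-⊕ []      = refl
zeros-⊕ (x ∷ u) = cong (x ∷_) (zeros-⊕ u)

⊕-cancelˡ : ∀ {k} (x u w : Vec ℕ k) → x ⊕ u ≡ x ⊕ w → u ≡ w
⊕-cancelˡ []      []      []      _  = refl
⊕-cancelˡ (a ∷ x) (b ∷ u) (c ∷ w) eq =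
  cong₂ _∷_ (NP.+-cancelˡ-≡ a b c (cong V.head eq)) (⊕-cancelˡ x u w (cong V.tail eq))

vsum-zeros : ∀ k → vsum (zeros k) ≡ 0
vsum-zeros zero    = refl
vsum-zeros (suc k) = vsum-zeros k

vsum-unit⊕ : ∀ {k} (b : Fin k) (w : Vec ℕ k) → vsum (unit b ⊕ w) ≡ suc (vsum w)
vsum-unit⊕ {suc k} F.zero    (x ∷ w) = cong (λ z → suc (x +ℕ vsum z)) (zeros-⊕ w)
vsum-unit⊕ {suc k} (F.suc b) (x ∷ w) = Eq.trans (cong (x +ℕ_) (vsum-unit⊕ b w)) (NP.+-suc x (vsum w))

vsum-unit : ∀ {k} (b : Fin k) → vsum (unit b) ≡ 1
vsum-unit {k} b = Eq.trans (cong vsum (Eq.sym (⊕-zeros (unit b)))) (Eq.trans (vsum-unit⊕ b (zeros k)) (cong suc (vsum-zeros k)))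
  where
  ⊕-zeros : ∀ {k} (u : Vec ℕ k) → u ⊕ zeros k ≡ u
  ⊕-zeros u = Eq.trans (⊕-comm u (zeros _)) (zeros-⊕ u)

lookup-unit⊕ : ∀ {k} (b : Fin k) (w : Vec ℕ k) → lookup (unit b ⊕ w) b ≡ suc (lookup w b)
lookup-unit⊕ F.zero    (x ∷ w) = refl
lookup-unit⊕ (F.suc b) (x ∷ w) = lookup-unit⊕ b w

vsum0⇒zeros : ∀ {k} (s : Vec ℕ k) → vsum s ≡ 0 → s ≡ zeros k
vsum0⇒zeros []         _  = refl
vsum0⇒zeros (zero ∷ s) eq = cong (0 ∷_) (vsum0⇒zeros s eq)

peel-unit : ∀ {k} n (s : Vec ℕ k) → vsum s ≡ suc n →
            Σ (Fin k) λ a → Σ (Vec ℕ k) λ s' → (vsum s' ≡ n) × (s ≡ unit a ⊕ s')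
peel-unit n (suc x ∷ s) eq = F.zero , x ∷ s , NP.suc-injective eq , cong (suc x ∷_) (Eq.sym (zeros-⊕ s))
peel-unit n (zero ∷ s)  eq with peel-unit n s eq
... | a , s' , eq' , refl = F.suc a , 0 ∷ s' , eq' , refl

unit-induction : ∀ {p k} (P : ℕ → Vec ℕ k → Set p) → P 0 (zeros k) →
                 (∀ n a s → vsum s ≡ n → P n s → P (suc n) (unit a ⊕ s)) →
                 ∀ n s → vsum s ≡ n → P n s
unit-induction P base step zero    s eq = subst (P 0) (Eq.sym (vsum0⇒zeros s eq)) base
unit-induction P base step (suc n) s eq with peel-unit n s eq
... | a , s' , eq' , refl = step n a s' eq' (unit-induction P base step n s' eq')

-- Removing one unit from coordinate b (used when that coordinate is positive).
_⊖_ : ∀ {k} → Vec ℕ k → Fin k → Vec ℕ k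
(x ∷ v) ⊖ F.zero  = pred x ∷ v
(x ∷ v) ⊖ F.suc b = x ∷ (v ⊖ b)

unit⊕⊖ : ∀ {k} (v : Vec ℕ k) (b : Fin k) {t} → lookup v b ≡ suc t → v ≡ unit b ⊕ (v ⊖ b)
unit⊕⊖ (suc x ∷ v) F.zero    refl = cong (suc x ∷_) (Eq.sym (zeros-⊕ v))
unit⊕⊖ (x ∷ v)     (F.suc b) eq   = cong (x ∷_) (unit⊕⊖ v b eq)

vsum-⊖ : ∀ {k} (v : Vec ℕ k) (b : Fin k) {t} → lookup v b ≡ suc t → vsum (v ⊖ b) ≡ pred (vsum v)
vsum-⊖ v b eq = cong pred (Eq.sym (Eq.trans (cong vsum (unit⊕⊖ v b eq)) (vsum-unit⊕ b (v ⊖ b))))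

vsum0⇒lookup0 : ∀ {k} (v : Vec ℕ k) → vsum v ≡ 0 → ∀ b → lookup v b ≡ 0
vsum0⇒lookup0 v eq b = Eq.trans (cong (λ w → lookup w b) (vsum0⇒zeros v eq)) (lookup-zeros b)
  where
  lookup-zeros : ∀ {k} (b : Fin k) → lookup (zeros k) b ≡ 0
  lookup-zeros F.zero    = refl
  lookup-zeros (F.suc b) = lookup-zeros b

-- Binomial coefficients by Pascal's rule: binom a b = (a+b choose a).
binom : ℕ → ℕ → ℕ
binom zero    b       = 1
binom (suc a) zero    = 1
binom (suc a) (suc b) = binom a (suc b) +ℕ binom (suc a) b

binom-zeroʳ : ∀ a → binom a 0 ≡ 1
binom-zeroʳ zero    = refl
binom-zeroʳ (suc a) = refl

binom-factorial : ∀ a b → binom a b *ℕ (a ! *ℕ b !) ≡ (a +ℕ b) !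
binom-factorial zero    b = Eq.trans (NP.*-identityˡ (1 *ℕ b !)) (NP.*-identityˡ (b !))
binom-factorial (suc a) zero rewrite NP.+-identityʳ a =
  Eq.trans (NP.*-identityˡ (suc a ! *ℕ 1)) (NP.*-identityʳ (suc a !))
binom-factorial (suc a) (suc b) = begin
  (binom a (suc b) +ℕ binom (suc a) b) *ℕ (suc a ! *ℕ suc b !)
    ≡⟨ split (binom a (suc b)) (binom (suc a) b) a b (a !) (b !) ⟩
  suc a *ℕ (binom a (suc b) *ℕ (a ! *ℕ suc b !)) +ℕ suc b *ℕ (binom (suc a) b *ℕ (suc a ! *ℕ b !))
    ≡⟨ cong₂ (λ x y → suc a *ℕ x +ℕ suc b *ℕ y) (binom-factorial a (suc b)) (binom-factorial (suc a) b) ⟩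
  suc a *ℕ (a +ℕ suc b) ! +ℕ suc b *ℕ (suc (a +ℕ b)) !
    ≡⟨ cong (λ z → suc a *ℕ (a +ℕ suc b) ! +ℕ suc b *ℕ z !) (Eq.sym (NP.+-suc a b)) ⟩
  suc a *ℕ (a +ℕ suc b) ! +ℕ suc b *ℕ (a +ℕ suc b) !
    ≡⟨ Eq.sym (NP.*-distribʳ-+ ((a +ℕ suc b) !) (suc a) (suc b)) ⟩
  (suc a +ℕ suc b) *ℕ (a +ℕ suc b) ! ∎
  where
  open Eq.≡-Reasoning
  open +-*-Solver
  split : ∀ X Y a b A B → (X +ℕ Y) *ℕ ((suc a *ℕ A) *ℕ (suc b *ℕ B)) ≡
            suc a *ℕ (X *ℕ (A *ℕ (suc b *ℕ B))) +ℕ suc b *ℕ (Y *ℕ ((suc a *ℕ A) *ℕ B))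
  split = solve 6 (λ X Y a b A B → (X :+ Y) :* (((con 1 :+ a) :* A) :* ((con 1 :+ b) :* B)) :=
            (con 1 :+ a) :* (X :* (A :* ((con 1 :+ b) :* B))) :+ (con 1 :+ b) :* (Y :* (((con 1 :+ a) :* A) :* B))) refl

multinomial : ∀ {k} → Vec ℕ k → ℕ
multinomial []       = 1
multinomial (x ∷ xs) = binom x (vsum xs) *ℕ multinomial xs

multinomial-factorial : ∀ {k} (v : Vec ℕ k) → (vsum v) ! ≡ multinomial v *ℕ vfact v
multinomial-factorial []       = refl
multinomial-factorial (x ∷ xs) = begin
  (x +ℕ vsum xs) !
    ≡⟨ Eq.sym (binom-factorial x (vsum xs)) ⟩
  binom x (vsum xs) *ℕ (x ! *ℕ (vsum xs) !)
    ≡⟨ cong (λ z → binom x (vsum xs) *ℕ (x ! *ℕ z)) (multinomial-factorial xs) ⟩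
  binom x (vsum xs) *ℕ (x ! *ℕ (multinomial xs *ℕ vfact xs))
    ≡⟨ regroup (binom x (vsum xs)) (x !) (multinomial xs) (vfact xs) ⟩
  binom x (vsum xs) *ℕ multinomial xs *ℕ (x ! *ℕ vfact xs) ∎
  where
  open Eq.≡-Reasoning
  open +-*-Solver
  regroup : ∀ a b c d → a *ℕ (b *ℕ (c *ℕ d)) ≡ a *ℕ c *ℕ (b *ℕ d)
  regroup = solve 4 (λ a b c d → a :* (b :* (c :* d)) := a :* c :* (b :* d)) refl

ifPos : ℕ → ℕ → ℕ
ifPos zero    _ = 0
ifPos (suc _) y = y

ΣFℕ : (k : ℕ) → (Fin k → ℕ) → ℕ
ΣFℕ zero    f = 0
ΣFℕ (suc k) f = f F.zero +ℕ ΣFℕ k (λ b → f (F.suc b))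

ΣFℕ-cong : ∀ k {f g : Fin k → ℕ} → (∀ b → f b ≡ g b) → ΣFℕ k f ≡ ΣFℕ k g
ΣFℕ-cong zero    eq = refl
ΣFℕ-cong (suc k) eq = cong₂ _+ℕ_ (eq F.zero) (ΣFℕ-cong k (λ b → eq (F.suc b)))

ΣFℕ-*ˡ : ∀ k c (f : Fin k → ℕ) → ΣFℕ k (λ b → c *ℕ f b) ≡ c *ℕ ΣFℕ k f
ΣFℕ-*ˡ zero    c f = Eq.sym (NP.*-zeroʳ c)
ΣFℕ-*ˡ (suc k) c f = Eq.trans (cong (c *ℕ f F.zero +ℕ_) (ΣFℕ-*ˡ k c (λ b → f (F.suc b))))
                              (Eq.sym (NP.*-distribˡ-+ c (f F.zero) _))

ΣFℕ-0 : ∀ k → ΣFℕ k (λ _ → 0) ≡ 0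
ΣFℕ-0 zero    = refl
ΣFℕ-0 (suc k) = ΣFℕ-0 k

multinomial-pascal : ∀ {k} (v : Vec ℕ k) m → vsum v ≡ suc m →
                     ΣFℕ k (λ b → ifPos (lookup v b) (multinomial (v ⊖ b))) ≡ multinomial v
multinomial-pascal {suc k} (x ∷ xs) m eq =
  Eq.trans (cong (ifPos x (binom (pred x) (vsum xs) *ℕ multinomial xs) +ℕ_)
             (Eq.trans (ΣFℕ-cong k tail-term) (ΣFℕ-*ˡ k (binom x (pred (vsum xs))) _)))
           (binom-step x (vsum xs) (multinomial xs) _ tail-sum-zero tail-sum-pos eq)
  where
  tailSum : ℕ
  tailSum = ΣFℕ k (λ b → ifPos (lookup xs b) (multinomial (xs ⊖ b)))
  tail-term : ∀ b → ifPos (lookup xs b) (binom x (vsum (xs ⊖ b)) *ℕ multinomial (xs ⊖ b))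
                    ≡ binom x (pred (vsum xs)) *ℕ ifPos (lookup xs b) (multinomial (xs ⊖ b))
  tail-term b with lookup xs b in eqb
  ... | zero  = Eq.sym (NP.*-zeroʳ (binom x (pred (vsum xs))))
  ... | suc t = cong (λ z → binom x z *ℕ multinomial (xs ⊖ b)) (vsum-⊖ xs b eqb)
  tail-sum-zero : vsum xs ≡ 0 → tailSum ≡ 0
  tail-sum-zero z = Eq.trans (ΣFℕ-cong k (λ b → cong (λ w → ifPos w (multinomial (xs ⊖ b))) (vsum0⇒lookup0 xs z b)))
                             (ΣFℕ-0 k)
  tail-sum-pos : ∀ N' → vsum xs ≡ suc N' → tailSum ≡ multinomial xs
  tail-sum-pos N' = multinomial-pascal xs N'
  -- the first-coordinate split combined with Pascal's rule for binom
  binom-step : ∀ x N M S → (N ≡ 0 → S ≡ 0) → (∀ N' → N ≡ suc N' → S ≡ M) → x +ℕ N ≡ suc m →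
               ifPos x (binom (pred x) N *ℕ M) +ℕ binom x (pred N) *ℕ S ≡ binom x N *ℕ M
  binom-step zero     (suc N') M S h0 hs _ rewrite hs N' refl = refl
  binom-step (suc x') zero     M S h0 hs _ rewrite h0 refl | binom-zeroʳ x' | NP.*-zeroʳ (binom (suc x') 0) = NP.+-identityʳ _
  binom-step (suc x') (suc N') M S h0 hs _ rewrite hs N' refl =
    Eq.sym (NP.*-distribʳ-+ M (binom x' (suc N')) (binom (suc x') N'))

HasRowSums : ∀ {m q} → Vec ℕ m → Vec (Vec ℕ q) m → Set
HasRowSums []       []        = ⊤
HasRowSums (s ∷ ss) (row ∷ r) = (vsum row ≡ s) × HasRowSums ss r

multinomialRows : ∀ {m q} → Vec (Vec ℕ q) m → ℕ
multinomialRows []        = 1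
multinomialRows (row ∷ r) = multinomial row *ℕ multinomialRows r

factProd-++ : ∀ xs ys → factProd (xs ++ ys) ≡ factProd xs *ℕ factProd ys
factProd-++ []       ys = Eq.sym (NP.+-identityʳ _)
factProd-++ (x ∷ xs) ys = Eq.trans (cong (x ! *ℕ_) (factProd-++ xs ys)) (Eq.sym (NP.*-assoc (x !) _ _))

vfact≡multinomialRows*famFact : ∀ {m q} (s : Vec ℕ m) (r : Vec (Vec ℕ q) m) → HasRowSums s r →
                                vfact s ≡ multinomialRows r *ℕ famFact r
vfact≡multinomialRows*famFact []        []        _          = refl
vfact≡multinomialRows*famFact (s ∷ ss) (row ∷ r) (refl , hr) = begin
  (vsum row) ! *ℕ vfact ss
    ≡⟨ cong₂ _*ℕ_ (multinomial-factorial row) (vfact≡multinomialRows*famFact ss r hr) ⟩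
  multinomial row *ℕ vfact row *ℕ (multinomialRows r *ℕ famFact r)
    ≡⟨ regroup (multinomial row) (vfact row) (multinomialRows r) (famFact r) ⟩
  multinomial row *ℕ multinomialRows r *ℕ (vfact row *ℕ famFact r)
    ≡⟨ cong (multinomial row *ℕ multinomialRows r *ℕ_) (Eq.sym (factProd-++ (toList row) _)) ⟩
  multinomialRows (row ∷ r) *ℕ famFact (row ∷ r) ∎
  where
  open Eq.≡-Reasoning
  open +-*-Solver
  regroup : ∀ a b c d → a *ℕ b *ℕ (c *ℕ d) ≡ a *ℕ c *ℕ (b *ℕ d)
  regroup = solve 4 (λ a b c d → a :* b :* (c :* d) := a :* c :* (b :* d)) refl

famCoeff≡multinomialRows : ∀ {m q} (s : Vec ℕ m) (r : Vec (Vec ℕ q) m) → HasRowSums s r →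
                           famCoeff s r ≡ multinomialRows r
famCoeff≡multinomialRows s r hr =
  Eq.trans (cong (λ z → (z / famFact r) {{factProd≢0 (concat (map toList (toList r)))}})
                 (vfact≡multinomialRows*famFact s r hr))
           (m*n/n≡m (multinomialRows r) (famFact r) {{factProd≢0 (concat (map toList (toList r)))}})

vsum-colSums : ∀ {m q} (s : Vec ℕ m) (r : Vec (Vec ℕ q) m) → HasRowSums s r → vsum (colSums r) ≡ vsum s
vsum-colSums {q = q} []       []        _          = vsum-zeros q
vsum-colSums         (s ∷ ss) (row ∷ r) (hrow , hr) =
  Eq.trans (vsum-⊕ row (colSums r)) (cong₂ _+ℕ_ hrow (vsum-colSums ss r hr))

compositions-suc : ∀ n k → compositions n (suc k) ≡
                   concatMap (λ i → map (i ∷_) (compositions (n ∸ i) k)) (upTo (suc n))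
compositions-suc zero    k = refl
compositions-suc (suc n) k = refl

module Inversion {c ℓ'} (K : InvolutiveCommRing c ℓ') where
  open InvolutiveCommRing K renaming (refl to ≈-refl)
  open WithRing K
  open import Relation.Binary.Reasoning.Setoid setoid
  open RingProperties (CommutativeRing.ring commRing) using (-1*x≈-x; -‿involutive)
  open RingSolver commutativeSemiring using (solve; _:=_; _:+_; _:*_)

  Σl-cong : ∀ {a} {A : Set a} (xs : List A) {f g : A → Carrier} → (∀ x → f x ≈ g x) → Σl xs f ≈ Σl xs g
  Σl-cong []       eq = ≈-refl
  Σl-cong (x ∷ xs) eq = +-cong (eq x) (Σl-cong xs eq)

  Σl-0 : ∀ {a} {A : Set a} (xs : List A) → Σl xs (λ _ → 0#) ≈ 0#
  Σl-0 []       = ≈-refl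
  Σl-0 (x ∷ xs) = trans (+-identityˡ _) (Σl-0 xs)

  Σl-+ : ∀ {a} {A : Set a} (xs : List A) (f g : A → Carrier) → Σl xs (λ x → f x + g x) ≈ Σl xs f + Σl xs g
  Σl-+ []       f g = sym (+-identityˡ 0#)
  Σl-+ (x ∷ xs) f g = trans (+-cong ≈-refl (Σl-+ xs f g)) (swap-middle (f x) (g x) (Σl xs f) (Σl xs g))
    where
    swap-middle : ∀ a b c d → a + b + (c + d) ≈ a + c + (b + d)
    swap-middle = solve 4 (λ a b c d → a :+ b :+ (c :+ d) := a :+ c :+ (b :+ d)) ≈-refl

  Σl-*ˡ : ∀ {a} {A : Set a} (xs : List A) (k : Carrier) (f : A → Carrier) → k * Σl xs f ≈ Σl xs (λ x → k * f x)
  Σl-*ˡ []       k f = zeroʳ k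
  Σl-*ˡ (x ∷ xs) k f = trans (distribˡ k (f x) (Σl xs f)) (+-cong ≈-refl (Σl-*ˡ xs k f))

  Σl-*ʳ : ∀ {a} {A : Set a} (xs : List A) (k : Carrier) (f : A → Carrier) → Σl xs f * k ≈ Σl xs (λ x → f x * k)
  Σl-*ʳ xs k f = trans (*-comm _ k) (trans (Σl-*ˡ xs k f) (Σl-cong xs (λ x → *-comm k (f x))))

  Σl-swap : ∀ {a b} {A : Set a} {B : Set b} (xs : List A) (ys : List B) (f : A → B → Carrier) →
            Σl xs (λ x → Σl ys (f x)) ≈ Σl ys (λ y → Σl xs (λ x → f x y))
  Σl-swap []       ys f = sym (Σl-0 ys)
  Σl-swap (x ∷ xs) ys f =
    trans (+-cong ≈-refl (Σl-swap xs ys f)) (sym (Σl-+ ys (f x) (λ y → Σl xs (λ x' → f x' y))))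

  Σl-++ : ∀ {a} {A : Set a} (xs ys : List A) (f : A → Carrier) → Σl (xs ++ ys) f ≈ Σl xs f + Σl ys f
  Σl-++ []       ys f = sym (+-identityˡ _)
  Σl-++ (x ∷ xs) ys f = trans (+-cong ≈-refl (Σl-++ xs ys f)) (sym (+-assoc _ _ _))

  Σl-concatMap : ∀ {a b} {A : Set a} {B : Set b} (g : A → List B) (xs : List A) (f : B → Carrier) →
                 Σl (concatMap g xs) f ≈ Σl xs (λ x → Σl (g x) f)
  Σl-concatMap g []       f = ≈-refl
  Σl-concatMap g (x ∷ xs) f = trans (Σl-++ (g x) (concatMap g xs) f) (+-cong ≈-refl (Σl-concatMap g xs f))

  Σl-map : ∀ {a b} {A : Set a} {B : Set b} (g : A → B) (xs : List A) (f : B → Carrier) →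
           Σl (map g xs) f ≡ Σl xs (λ x → f (g x))
  Σl-map g []       f = refl
  Σl-map g (x ∷ xs) f = cong (f (g x) +_) (Σl-map g xs f)

  ΣN : ℕ → (ℕ → Carrier) → Carrier
  ΣN zero    h = 0#
  ΣN (suc m) h = h 0 + ΣN m (λ i → h (suc i))

  Σl-applyUpTo : ∀ (f : ℕ → ℕ) m (h : ℕ → Carrier) → Σl (applyUpTo f m) h ≡ ΣN m (λ i → h (f i))
  Σl-applyUpTo f zero    h = refl
  Σl-applyUpTo f (suc m) h = cong (h (f 0) +_) (Σl-applyUpTo (λ i → f (suc i)) m h)

  ΣN-cong : ∀ m {h h' : ℕ → Carrier} → (∀ i → i < m → h i ≈ h' i) → ΣN m h ≈ ΣN m h'
  ΣN-cong zero    eq = ≈-refl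
  ΣN-cong (suc m) eq = +-cong (eq 0 (s≤s z≤n)) (ΣN-cong m (λ i i<m → eq (suc i) (s≤s i<m)))

  indicator : ∀ {a} {A : Set a} → Dec A → Carrier
  indicator (yes _) = 1#
  indicator (no _)  = 0#

  indicator-yes : ∀ {a} {A : Set a} (d : Dec A) → A → indicator d ≈ 1#
  indicator-yes (yes _) _ = ≈-refl
  indicator-yes (no ¬p) p = ⊥-elim (¬p p)

  indicator-no : ∀ {a} {A : Set a} (d : Dec A) → ¬ A → indicator d ≈ 0#
  indicator-no (yes p) ¬p = ⊥-elim (¬p p)
  indicator-no (no _)  _  = ≈-refl

  δℕ : ℕ → ℕ → Carrier
  δℕ x y = indicator (x ≟ y)

  δ : ∀ {k} → Vec ℕ k → Vec ℕ k → Carrier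
  δ u w = indicator (≡-dec _≟_ u w)

  δ-yes : ∀ {k} (u w : Vec ℕ k) → u ≡ w → δ u w ≈ 1#
  δ-yes u w = indicator-yes (≡-dec _≟_ u w)

  δ-no : ∀ {k} (u w : Vec ℕ k) → u ≢ w → δ u w ≈ 0#
  δ-no u w = indicator-no (≡-dec _≟_ u w)

  δ-sym : ∀ {k} (u w : Vec ℕ k) → δ u w ≈ δ w u
  δ-sym u w = by-cases (≡-dec _≟_ u w)
    where
    by-cases : Dec (u ≡ w) → δ u w ≈ δ w u
    by-cases (yes p) = trans (δ-yes u w p) (sym (δ-yes w u (Eq.sym p)))
    by-cases (no ¬p) = trans (δ-no u w ¬p) (sym (δ-no w u (λ q → ¬p (Eq.sym q))))

  δ-cons : ∀ {k} x y (xs ys : Vec ℕ k) → δ (x ∷ xs) (y ∷ ys) ≈ δℕ x y * δ xs ys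
  δ-cons x y xs ys = by-cases (x ≟ y) (≡-dec _≟_ xs ys)
    where
    by-cases : Dec (x ≡ y) → Dec (xs ≡ ys) → δ (x ∷ xs) (y ∷ ys) ≈ δℕ x y * δ xs ys
    by-cases (yes p) (yes q) = trans (δ-yes _ _ (cong₂ _∷_ p q))
                                     (sym (trans (*-cong (indicator-yes (x ≟ y) p) (δ-yes xs ys q)) (*-identityˡ 1#)))
    by-cases (no ¬p) _       = trans (δ-no (x ∷ xs) (y ∷ ys) (λ eq → ¬p (cong V.head eq)))
                                     (sym (trans (*-cong (indicator-no (x ≟ y) ¬p) ≈-refl) (zeroˡ _)))
    by-cases (yes _) (no ¬q) = trans (δ-no (x ∷ xs) (y ∷ ys) (λ eq → ¬q (cong V.tail eq)))
                                     (sym (trans (*-cong ≈-refl (δ-no xs ys ¬q)) (zeroʳ _)))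

  δ-subst : ∀ {k} (u w : Vec ℕ k) (f : Vec ℕ k → Carrier) → δ u w * f u ≈ δ u w * f w
  δ-subst u w f = by-cases (≡-dec _≟_ u w)
    where
    by-cases : Dec (u ≡ w) → δ u w * f u ≈ δ u w * f w
    by-cases (yes refl) = ≈-refl
    by-cases (no ¬p)    = trans (*-cong (δ-no u w ¬p) ≈-refl)
                                (trans (zeroˡ _) (sym (trans (*-cong (δ-no u w ¬p) ≈-refl) (zeroˡ _))))

  ΣN-δ : ∀ m j → j < m → (Z : ℕ → Carrier) → ΣN m (λ i → δℕ i j * Z i) ≈ Z j
  ΣN-δ (suc m) zero    _ Z =
    trans (+-cong (*-identityˡ _) (trans (ΣN-cong m (λ i _ → zeroˡ _)) (ΣN-0 m))) (+-identityʳ _)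
    where
    ΣN-0 : ∀ m → ΣN m (λ _ → 0#) ≈ 0#
    ΣN-0 zero    = ≈-refl
    ΣN-0 (suc m) = trans (+-identityˡ _) (ΣN-0 m)
  ΣN-δ (suc m) (suc j) (s≤s j<m) Z =
    trans (+-cong (zeroˡ _) (ΣN-cong m (λ i _ → *-cong (δℕ-suc i j) ≈-refl)))
          (trans (+-identityˡ _) (ΣN-δ m j j<m (λ i → Z (suc i))))
    where
    δℕ-suc : ∀ i j → δℕ (suc i) (suc j) ≈ δℕ i j
    δℕ-suc i j = by-cases (i ≟ j)
      where
      by-cases : Dec (i ≡ j) → δℕ (suc i) (suc j) ≈ δℕ i j
      by-cases (yes p) = trans (indicator-yes (suc i ≟ suc j) (cong suc p)) (sym (indicator-yes (i ≟ j) p))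
      by-cases (no ¬p) = trans (indicator-no (suc i ≟ suc j) (λ q → ¬p (NP.suc-injective q))) (sym (indicator-no (i ≟ j) ¬p))

  ΣV-suc : ∀ n k (f : Vec ℕ (suc k) → Carrier) →
           ΣV n (suc k) f ≈ ΣN (suc n) (λ i → ΣV (n ∸ i) k (λ w → f (i ∷ w)))
  ΣV-suc n k f rewrite compositions-suc n k = begin
    Σl (concatMap (λ i → map (i ∷_) (compositions (n ∸ i) k)) (upTo (suc n))) f
      ≈⟨ Σl-concatMap (λ i → map (i ∷_) (compositions (n ∸ i) k)) (upTo (suc n)) f ⟩
    Σl (upTo (suc n)) (λ i → Σl (map (i ∷_) (compositions (n ∸ i) k)) f)
      ≈⟨ Σl-cong (upTo (suc n)) (λ i → reflexive (Σl-map (i ∷_) (compositions (n ∸ i) k) f)) ⟩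
    Σl (upTo (suc n)) (λ i → ΣV (n ∸ i) k (λ w → f (i ∷ w)))
      ≡⟨ Σl-applyUpTo (λ i → i) (suc n) _ ⟩
    ΣN (suc n) (λ i → ΣV (n ∸ i) k (λ w → f (i ∷ w))) ∎

  ΣV-cong : ∀ n k {f g : Vec ℕ k → Carrier} → (∀ i → vsum i ≡ n → f i ≈ g i) → ΣV n k f ≈ ΣV n k g
  ΣV-cong zero    zero    eq = +-cong (eq [] refl) ≈-refl
  ΣV-cong (suc n) zero    eq = ≈-refl
  ΣV-cong n       (suc k) {f} {g} eq =
    trans (ΣV-suc n k f) (trans (ΣN-cong (suc n) (λ i i≤n → ΣV-cong (n ∸ i) k (λ w eqw →
      eq (i ∷ w) (Eq.trans (cong (i +ℕ_) eqw) (NP.m+[n∸m]≡n (NP.≤-pred i≤n))))))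
      (sym (ΣV-suc n k g)))

  ΣV-δ : ∀ n {k} (j : Vec ℕ k) → vsum j ≡ n → (X : Vec ℕ k → Carrier) → ΣV n k (λ i → δ i j * X i) ≈ X j
  ΣV-δ .0 []       refl X = trans (+-identityʳ _) (*-identityˡ _)
  ΣV-δ n  {suc k} (j0 ∷ j') eq X = begin
    ΣV n (suc k) (λ i → δ i (j0 ∷ j') * X i)
      ≈⟨ ΣV-suc n k _ ⟩
    ΣN (suc n) (λ i → ΣV (n ∸ i) k (λ w → δ (i ∷ w) (j0 ∷ j') * X (i ∷ w)))
      ≈⟨ ΣN-cong (suc n) (λ i _ → factor-δℕ i) ⟩
    ΣN (suc n) (λ i → δℕ i j0 * ΣV (n ∸ i) k (λ w → δ w j' * X (i ∷ w)))
      ≈⟨ ΣN-δ (suc n) j0 (s≤s j0≤n) (λ i → ΣV (n ∸ i) k (λ w → δ w j' * X (i ∷ w))) ⟩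
    ΣV (n ∸ j0) k (λ w → δ w j' * X (j0 ∷ w))
      ≈⟨ ΣV-δ (n ∸ j0) j' (Eq.trans (Eq.sym (NP.m+n∸m≡n j0 (vsum j'))) (cong (_∸ j0) eq)) (λ w → X (j0 ∷ w)) ⟩
    X (j0 ∷ j') ∎
    where
    j0≤n : j0 ≤ n
    j0≤n = subst (j0 ≤_) eq (NP.m≤m+n j0 (vsum j'))
    factor-δℕ : ∀ i → ΣV (n ∸ i) k (λ w → δ (i ∷ w) (j0 ∷ j') * X (i ∷ w))
                      ≈ δℕ i j0 * ΣV (n ∸ i) k (λ w → δ w j' * X (i ∷ w))
    factor-δℕ i = trans (Σl-cong (compositions (n ∸ i) k) (λ w → trans (*-cong (δ-cons i j0 w j') ≈-refl) (*-assoc _ _ _)))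
                        (sym (Σl-*ˡ (compositions (n ∸ i) k) (δℕ i j0) (λ w → δ w j' * X (i ∷ w))))

  ΣV-δ′ : ∀ n {k} (j : Vec ℕ k) → vsum j ≡ n → (X : Vec ℕ k → Carrier) → ΣV n k (λ i → δ j i * X i) ≈ X j
  ΣV-δ′ n {k} j eq X = trans (Σl-cong (compositions n k) (λ i → *-cong (δ-sym j i) ≈-refl)) (ΣV-δ n j eq X)

  rowFamilies-cong : ∀ {m} q (s : Vec ℕ m) {f g : Vec (Vec ℕ q) m → Carrier} → (∀ r → HasRowSums s r → f r ≈ g r) →
                     Σl (rowFamilies q s) f ≈ Σl (rowFamilies q s) g
  rowFamilies-cong q []        eq = +-cong (eq [] tt) ≈-refl
  rowFamilies-cong q (s0 ∷ ss) {f} {g} eq =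
    trans (Σl-concatMap (λ row → map (row ∷_) (rowFamilies q ss)) (compositions s0 q) f)
    (trans (ΣV-cong s0 q (λ row eqr →
       trans (reflexive (Σl-map (row ∷_) (rowFamilies q ss) f))
       (trans (rowFamilies-cong q ss (λ r hr → eq (row ∷ r) (eqr , hr)))
              (sym (reflexive (Σl-map (row ∷_) (rowFamilies q ss) g))))))
    (sym (Σl-concatMap (λ row → map (row ∷_) (rowFamilies q ss)) (compositions s0 q) g)))

  Σl-filter : ∀ {a p} {A : Set a} {P : A → Set p} (P? : ∀ x → Dec (P x)) (xs : List A) (f : A → Carrier) →
              Σl (filter P? xs) f ≈ Σl xs (λ x → indicator (P? x) * f x)
  Σl-filter P? []       f = ≈-refl
  Σl-filter P? (x ∷ xs) f with P? x
  ... | yes _ = +-cong (sym (*-identityˡ _)) (Σl-filter P? xs f)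
  ... | no _  = trans (sym (+-identityˡ _)) (+-cong (sym (zeroˡ _)) (Σl-filter P? xs f))

  -- Convolution of coefficient functions of homogeneous polynomials of degrees d1, d2:
  -- conv d1 d2 f g is the coefficient function of the product (the Cauchy product on V).

  conv : ∀ {k} → ℕ → ℕ → (Vec ℕ k → Carrier) → (Vec ℕ k → Carrier) → Vec ℕ k → Carrier
  conv {k} d1 d2 f g p = ΣV d1 k (λ u → ΣV d2 k (λ w → f u * g w * δ (u ⊕ w) p))

  conv-cong : ∀ {k} d1 d2 {f f' g g' : Vec ℕ k → Carrier} →
              (∀ u → vsum u ≡ d1 → f u ≈ f' u) → (∀ w → vsum w ≡ d2 → g w ≈ g' w) →
              ∀ p → conv d1 d2 f g p ≈ conv d1 d2 f' g' p
  conv-cong {k} d1 d2 ef eg p =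
    ΣV-cong d1 k (λ u eu → ΣV-cong d2 k (λ w ew → *-cong (*-cong (ef u eu) (eg w ew)) ≈-refl))

  conv-comm : ∀ {k} d1 d2 (f g : Vec ℕ k → Carrier) p → conv d1 d2 f g p ≈ conv d2 d1 g f p
  conv-comm {k} d1 d2 f g p =
    trans (Σl-swap (compositions d1 k) (compositions d2 k) (λ u w → f u * g w * δ (u ⊕ w) p))
          (Σl-cong (compositions d2 k) (λ w → Σl-cong (compositions d1 k) (λ u →
             *-cong (*-comm (f u) (g w)) (reflexive (cong (λ z → δ z p) (⊕-comm u w))))))

  -- The coefficient function of a triple product; both bracketings of conv reduce to it.
  conv₃ : ∀ {k} → ℕ → ℕ → ℕ → (f g h : Vec ℕ k → Carrier) → Vec ℕ k → Carrier
  conv₃ {k} d1 d2 d3 f g h p =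
    ΣV d1 k (λ u → ΣV d2 k (λ w → ΣV d3 k (λ z → f u * g w * (h z * δ ((u ⊕ w) ⊕ z) p))))

  conv-assocˡ : ∀ {k} d1 d2 d3 (f g h : Vec ℕ k → Carrier) p →
                conv (d1 +ℕ d2) d3 (conv d1 d2 f g) h p ≈ conv₃ d1 d2 d3 f g h p
  conv-assocˡ {k} d1 d2 d3 f g h p = begin
    Σl (Vl (d1 +ℕ d2)) (λ x → Σl (Vl d3) (λ z → conv d1 d2 f g x * h z * δ (x ⊕ z) p))
      ≈⟨ Σl-cong (Vl (d1 +ℕ d2)) (λ x → Σl-cong (Vl d3) (λ z →
           trans (*-assoc _ _ _) (trans (Σl-*ʳ (Vl d1) _ _) (Σl-cong (Vl d1) (λ u → Σl-*ʳ (Vl d2) _ _))))) ⟩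
    Σl (Vl (d1 +ℕ d2)) (λ x → Σl (Vl d3) (λ z → Σl (Vl d1) (λ u → Σl (Vl d2) (λ w → T x u w z))))
      ≈⟨ trans (Σl-swap (Vl (d1 +ℕ d2)) (Vl d3) _) (Σl-cong (Vl d3) (λ z → trans (Σl-swap (Vl (d1 +ℕ d2)) (Vl d1) _)
            (Σl-cong (Vl d1) (λ u → Σl-swap (Vl (d1 +ℕ d2)) (Vl d2) _)))) ⟩
    Σl (Vl d3) (λ z → Σl (Vl d1) (λ u → Σl (Vl d2) (λ w → Σl (Vl (d1 +ℕ d2)) (λ x → T x u w z))))
      ≈⟨ Σl-cong (Vl d3) (λ z → ΣV-cong d1 k (λ u eu → ΣV-cong d2 k (λ w ew →
           trans (Σl-cong (Vl (d1 +ℕ d2)) (λ x → regroup (f u) (g w) (δ (u ⊕ w) x) (h z) (δ (x ⊕ z) p)))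
                 (ΣV-δ′ (d1 +ℕ d2) (u ⊕ w) (Eq.trans (vsum-⊕ u w) (cong₂ _+ℕ_ eu ew))
                        (λ x → f u * g w * (h z * δ (x ⊕ z) p)))))) ⟩
    Σl (Vl d3) (λ z → Σl (Vl d1) (λ u → Σl (Vl d2) (λ w → f u * g w * (h z * δ ((u ⊕ w) ⊕ z) p))))
      ≈⟨ trans (Σl-swap (Vl d3) (Vl d1) _) (Σl-cong (Vl d1) (λ u → Σl-swap (Vl d3) (Vl d2) _)) ⟩
    conv₃ d1 d2 d3 f g h p ∎
    where
    Vl : ℕ → List (Vec ℕ k)
    Vl n = compositions n k
    T : Vec ℕ k → Vec ℕ k → Vec ℕ k → Vec ℕ k → Carrier
    T x u w z = f u * g w * δ (u ⊕ w) x * (h z * δ (x ⊕ z) p)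
    regroup : ∀ a b c d e → a * b * c * (d * e) ≈ c * (a * b * (d * e))
    regroup = solve 5 (λ a b c d e → a :* b :* c :* (d :* e) := c :* (a :* b :* (d :* e))) ≈-refl

  conv-assocʳ : ∀ {k} d1 d2 d3 (f g h : Vec ℕ k → Carrier) p →
                conv d1 (d2 +ℕ d3) f (conv d2 d3 g h) p ≈ conv₃ d1 d2 d3 f g h p
  conv-assocʳ {k} d1 d2 d3 f g h p = begin
    Σl (Vl d1) (λ u → Σl (Vl (d2 +ℕ d3)) (λ y → f u * conv d2 d3 g h y * δ (u ⊕ y) p))
      ≈⟨ Σl-cong (Vl d1) (λ u → Σl-cong (Vl (d2 +ℕ d3)) (λ y →
           trans (pull-out (f u) _ (δ (u ⊕ y) p)) (trans (Σl-*ʳ (Vl d2) _ _) (Σl-cong (Vl d2) (λ w → Σl-*ʳ (Vl d3) _ _))))) ⟩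
    Σl (Vl d1) (λ u → Σl (Vl (d2 +ℕ d3)) (λ y → Σl (Vl d2) (λ w → Σl (Vl d3) (λ z → T y u w z))))
      ≈⟨ Σl-cong (Vl d1) (λ u → trans (Σl-swap (Vl (d2 +ℕ d3)) (Vl d2) _)
            (Σl-cong (Vl d2) (λ w → Σl-swap (Vl (d2 +ℕ d3)) (Vl d3) _))) ⟩
    Σl (Vl d1) (λ u → Σl (Vl d2) (λ w → Σl (Vl d3) (λ z → Σl (Vl (d2 +ℕ d3)) (λ y → T y u w z))))
      ≈⟨ Σl-cong (Vl d1) (λ u → ΣV-cong d2 k (λ w ew → ΣV-cong d3 k (λ z ez →
           trans (Σl-cong (Vl (d2 +ℕ d3)) (λ y → regroup (f u) (g w) (h z) (δ (w ⊕ z) y) (δ (u ⊕ y) p)))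
           (trans (ΣV-δ′ (d2 +ℕ d3) (w ⊕ z) (Eq.trans (vsum-⊕ w z) (cong₂ _+ℕ_ ew ez))
                      (λ y → f u * g w * (h z * δ (u ⊕ y) p)))
                  (reflexive (cong (λ t → f u * g w * (h z * δ t p)) (Eq.sym (⊕-assoc u w z)))))))) ⟩
    conv₃ d1 d2 d3 f g h p ∎
    where
    Vl : ℕ → List (Vec ℕ k)
    Vl n = compositions n k
    T : Vec ℕ k → Vec ℕ k → Vec ℕ k → Vec ℕ k → Carrier
    T y u w z = g w * h z * δ (w ⊕ z) y * (f u * δ (u ⊕ y) p)
    pull-out : ∀ a s d → a * s * d ≈ s * (a * d)
    pull-out = solve 3 (λ a s d → a :* s :* d := s :* (a :* d)) ≈-refl
    regroup : ∀ a b c d e → b * c * d * (a * e) ≈ d * (a * b * (c * e))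
    regroup = solve 5 (λ a b c d e → b :* c :* d :* (a :* e) := d :* (a :* b :* (c :* e))) ≈-refl

  conv-assoc : ∀ {k} d1 d2 d3 (f g h : Vec ℕ k → Carrier) p →
               conv (d1 +ℕ d2) d3 (conv d1 d2 f g) h p ≈ conv d1 (d2 +ℕ d3) f (conv d2 d3 g h) p
  conv-assoc d1 d2 d3 f g h p = trans (conv-assocˡ d1 d2 d3 f g h p) (sym (conv-assocʳ d1 d2 d3 f g h p))

  conv-scaleˡ : ∀ {k} d1 d2 (a : Carrier) (f g : Vec ℕ k → Carrier) p →
                conv d1 d2 (λ u → a * f u) g p ≈ a * conv d1 d2 f g p
  conv-scaleˡ {k} d1 d2 a f g p =
    trans (Σl-cong (compositions d1 k) (λ u → trans (Σl-cong (compositions d2 k) (λ w → reassoc (f u) (g w) (δ (u ⊕ w) p)))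
                                                     (sym (Σl-*ˡ (compositions d2 k) a _))))
          (sym (Σl-*ˡ (compositions d1 k) a _))
    where
    reassoc : ∀ x y z → a * x * y * z ≈ a * (x * y * z)
    reassoc = solve 4 (λ a x y z → a :* x :* y :* z := a :* (x :* y :* z)) ≈-refl a

  conv-scaleʳ : ∀ {k} d1 d2 (a : Carrier) (f g : Vec ℕ k → Carrier) p →
                conv d1 d2 f (λ w → a * g w) p ≈ a * conv d1 d2 f g p
  conv-scaleʳ d1 d2 a f g p =
    trans (conv-comm d1 d2 f _ p) (trans (conv-scaleˡ d2 d1 a g f p) (*-cong ≈-refl (conv-comm d2 d1 g f p)))

  conv-zeros : ∀ {k} (f g : Vec ℕ k → Carrier) p → conv 0 0 f g p ≈ f (zeros k) * g (zeros k) * δ (zeros k) p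
  conv-zeros {k} f g p = trans (ΣV-zero (λ u → ΣV 0 k (λ w → f u * g w * δ (u ⊕ w) p)))
                               (trans (ΣV-zero (λ w → f (zeros k) * g w * δ (zeros k ⊕ w) p)) (reflexive (cong (λ z → f (zeros k) * g (zeros k) * δ z p) (zeros-⊕ (zeros k)))))
    where
    ΣV-zero : ∀ {k} (h : Vec ℕ k → Carrier) → ΣV 0 k h ≈ h (zeros k)
    ΣV-zero {zero}  h = +-identityʳ _
    ΣV-zero {suc k} h = trans (ΣV-suc 0 k h) (trans (+-identityʳ _) (ΣV-zero (λ w → h (0 ∷ w))))

  ofℕ-+ : ∀ m n → ofℕ (m +ℕ n) ≈ ofℕ m + ofℕ n
  ofℕ-+ zero    n = sym (+-identityˡ _)
  ofℕ-+ (suc m) n = trans (+-cong ≈-refl (ofℕ-+ m n)) (sym (+-assoc _ _ _))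

  ofℕ-* : ∀ m n → ofℕ (m *ℕ n) ≈ ofℕ m * ofℕ n
  ofℕ-* zero    n = sym (zeroˡ _)
  ofℕ-* (suc m) n = trans (ofℕ-+ n (m *ℕ n)) (trans (+-cong (sym (*-identityˡ _)) (ofℕ-* m n)) (sym (distribʳ _ _ _)))

  monomialRow : ∀ {k} → (Fin k → Carrier) → Vec ℕ k → Carrier
  monomialRow {zero}  x []       = 1#
  monomialRow {suc k} x (y ∷ ys) = pow (x F.zero) y * monomialRow (λ b → x (F.suc b)) ys

  monomialRows : ∀ {m k} → (Fin m → Fin k → Carrier) → Vec (Vec ℕ k) m → Carrier
  monomialRows A []        = 1#
  monomialRows A (row ∷ r) = monomialRow (A F.zero) row * monomialRows (λ a → A (F.suc a)) r

  monomial≡monomialRows : ∀ {k} (A : Matrix k) (r : Vec (Vec ℕ k) k) → monomial A r ≡ monomialRows A r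
  monomial≡monomialRows {k} A r = Eq.trans (Πl-allFin (λ a → Πl (toList (allFin k)) (λ b → pow (A a b) (lookup (lookup r a) b))))
                                           (by-rows A r)
    where
    ΠF : (m : ℕ) → (Fin m → Carrier) → Carrier
    ΠF zero    h = 1#
    ΠF (suc m) h = h F.zero * ΠF m (λ i → h (F.suc i))
    Πl-tabulate : ∀ {m} (f : Fin m → Fin k) (h : Fin k → Carrier) → Πl (toList (tabulate f)) h ≡ ΠF m (λ i → h (f i))
    Πl-tabulate {zero}  f h = refl
    Πl-tabulate {suc m} f h = cong (h (f F.zero) *_) (Πl-tabulate (λ i → f (F.suc i)) h)
    Πl-allFin : ∀ (h : Fin k → Carrier) → Πl (toList (allFin k)) h ≡ ΠF k h
    Πl-allFin h = Πl-tabulate (λ a → a) h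
    ΠF-monomialRow : ∀ {m} (x : Fin m → Carrier) (v : Vec ℕ m) → ΠF m (λ b → pow (x b) (lookup v b)) ≡ monomialRow x v
    ΠF-monomialRow x []       = refl
    ΠF-monomialRow x (y ∷ ys) = cong (pow (x F.zero) y *_) (ΠF-monomialRow (λ b → x (F.suc b)) ys)
    by-rows : ∀ {m} (A : Fin m → Fin k → Carrier) (r : Vec (Vec ℕ k) m) →
              ΠF m (λ a → Πl (toList (allFin k)) (λ b → pow (A a b) (lookup (lookup r a) b))) ≡ monomialRows A r
    by-rows A []        = refl
    by-rows A (row ∷ r) = cong₂ _*_ (Eq.trans (Πl-allFin (λ b → pow (A F.zero b) (lookup row b))) (ΠF-monomialRow (A F.zero) row))
                                    (by-rows (λ a → A (F.suc a)) r)

  -- rowCoeff x v = multinomial(v) ∏ x_b^{v_b} is the coefficient of X^v in (Σ_b x_b X_b)^{|v|}.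
  rowCoeff : ∀ {k} → (Fin k → Carrier) → Vec ℕ k → Carrier
  rowCoeff x v = ofℕ (multinomial v) * monomialRow x v

  -- prodCoeff A s p is the coefficient of X^p in ∏_a (Σ_b A_ab X_b)^{s_a}, as an iterated convolution.
  prodCoeff : ∀ {m k} → (Fin m → Fin k → Carrier) → Vec ℕ m → Vec ℕ k → Carrier
  prodCoeff {zero}  {k} A []        p = δ (zeros k) p
  prodCoeff {suc m}     A (s0 ∷ ss) p = conv s0 (vsum ss) (rowCoeff (A F.zero)) (prodCoeff (λ a → A (F.suc a)) ss) p

  Σfamilies≈prodCoeff : ∀ {m} q (A : Fin m → Fin q → Carrier) (s : Vec ℕ m) p →
    Σl (rowFamilies q s) (λ r → δ (colSums r) p * (ofℕ (multinomialRows r) * monomialRows A r)) ≈ prodCoeff A s p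
  Σfamilies≈prodCoeff q A []        p = trans (+-identityʳ _) (trans (*-cong ≈-refl (trans (*-identityʳ _) (+-identityʳ _))) (*-identityʳ _))
  Σfamilies≈prodCoeff q A (s0 ∷ ss) p = begin
    Σl (concatMap (λ row → map (row ∷_) RF) (Vl s0)) F
      ≈⟨ Σl-concatMap (λ row → map (row ∷_) RF) (Vl s0) F ⟩
    Σl (Vl s0) (λ row → Σl (map (row ∷_) RF) F)
      ≈⟨ Σl-cong (Vl s0) (λ row → trans (reflexive (Σl-map (row ∷_) RF F)) (Σl-cong RF (λ r → split-first-row row r))) ⟩
    Σl (Vl s0) (λ u → Σl RF (λ r → rowCoeff A0 u * Y r * δ (u ⊕ colSums r) p))
      ≈⟨ Σl-cong (Vl s0) (λ u → rowFamilies-cong q ss (λ r hr → sym (ΣV-δ′ N (colSums r) (vsum-colSums ss r hr)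
                                                 (λ w → rowCoeff A0 u * Y r * δ (u ⊕ w) p)))) ⟩
    Σl (Vl s0) (λ u → Σl RF (λ r → Σl (Vl N) (λ w → δ (colSums r) w * (rowCoeff A0 u * Y r * δ (u ⊕ w) p))))
      ≈⟨ Σl-cong (Vl s0) (λ u → Σl-swap RF (Vl N) _) ⟩
    Σl (Vl s0) (λ u → Σl (Vl N) (λ w → Σl RF (λ r → δ (colSums r) w * (rowCoeff A0 u * Y r * δ (u ⊕ w) p))))
      ≈⟨ Σl-cong (Vl s0) (λ u → Σl-cong (Vl N) (λ w → inner-sum u w)) ⟩
    Σl (Vl s0) (λ u → Σl (Vl N) (λ w → rowCoeff A0 u * prodCoeff A' ss w * δ (u ⊕ w) p)) ∎
    where
    Vl : ℕ → List (Vec ℕ q)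
    Vl n = compositions n q
    N = vsum ss
    RF = rowFamilies q ss
    A0 = A F.zero
    A' : _ → Fin q → Carrier
    A' a = A (F.suc a)
    Y : Vec (Vec ℕ q) _ → Carrier
    Y r = ofℕ (multinomialRows r) * monomialRows A' r
    F : Vec (Vec ℕ q) _ → Carrier
    F r = δ (colSums r) p * (ofℕ (multinomialRows r) * monomialRows A r)
    split-first-row : ∀ row r → F (row ∷ r) ≈ rowCoeff A0 row * Y r * δ (row ⊕ colSums r) p
    split-first-row row r = trans (*-cong ≈-refl (*-cong (ofℕ-* (multinomial row) (multinomialRows r)) ≈-refl))
      (regroup (δ (row ⊕ colSums r) p) (ofℕ (multinomial row)) (ofℕ (multinomialRows r)) (monomialRow A0 row) (monomialRows A' r))
      where
      regroup : ∀ d a b x y → d * (a * b * (x * y)) ≈ a * x * (b * y) * d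
      regroup = solve 5 (λ d a b x y → d :* (a :* b :* (x :* y)) := a :* x :* (b :* y) :* d) ≈-refl
    inner-sum : ∀ u w → Σl RF (λ r → δ (colSums r) w * (rowCoeff A0 u * Y r * δ (u ⊕ w) p))
                        ≈ rowCoeff A0 u * prodCoeff A' ss w * δ (u ⊕ w) p
    inner-sum u w =
      trans (Σl-cong RF (λ r → regroup (δ (colSums r) w) (rowCoeff A0 u) (Y r) (δ (u ⊕ w) p)))
      (trans (sym (Σl-*ʳ RF (δ (u ⊕ w) p) _))
      (*-cong (trans (sym (Σl-*ˡ RF (rowCoeff A0 u) _)) (*-cong ≈-refl (Σfamilies≈prodCoeff q A' ss w))) ≈-refl))
      where
      regroup : ∀ d a y e → d * (a * y * e) ≈ a * (d * y) * e
      regroup = solve 4 (λ d a y e → d :* (a :* y :* e) := a :* (d :* y) :* e) ≈-refl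

  MG≈prodCoeff : ∀ {q} (G : Matrix q) p s → MG G p s ≈ prodCoeff G s p
  MG≈prodCoeff {q} G p s =
    trans (Σl-filter (λ r → ≡-dec _≟_ (colSums r) p) (rowFamilies q s) _)
    (trans (rowFamilies-cong q s (λ r hr → *-cong ≈-refl
              (*-cong (reflexive (cong ofℕ (famCoeff≡multinomialRows s r hr))) (reflexive (monomial≡monomialRows G r)))))
           (Σfamilies≈prodCoeff q G s p))

  finList : ∀ k → List (Fin k)
  finList zero    = []
  finList (suc k) = F.zero ∷ map F.suc (finList k)

  ΣFin≡Σl : ∀ k (f : Fin k → Carrier) → ΣFin k f ≡ Σl (finList k) f
  ΣFin≡Σl zero    f = refl
  ΣFin≡Σl (suc k) f = cong (f F.zero +_) (Eq.trans (ΣFin≡Σl k (λ b → f (F.suc b))) (Eq.sym (Σl-map F.suc (finList k) f)))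

  ΣFin-cong : ∀ k {f g : Fin k → Carrier} → (∀ b → f b ≈ g b) → ΣFin k f ≈ ΣFin k g
  ΣFin-cong k {f} {g} eq = trans (reflexive (ΣFin≡Σl k f)) (trans (Σl-cong (finList k) eq) (reflexive (Eq.sym (ΣFin≡Σl k g))))

  ΣFin-*ˡ : ∀ k a (f : Fin k → Carrier) → a * ΣFin k f ≈ ΣFin k (λ b → a * f b)
  ΣFin-*ˡ k a f = trans (*-cong ≈-refl (reflexive (ΣFin≡Σl k f))) (trans (Σl-*ˡ (finList k) a f) (reflexive (Eq.sym (ΣFin≡Σl k _))))

  ΣFin-*ʳ : ∀ k (f : Fin k → Carrier) a → ΣFin k f * a ≈ ΣFin k (λ b → f b * a)
  ΣFin-*ʳ k f a = trans (*-cong (reflexive (ΣFin≡Σl k f)) ≈-refl) (trans (Σl-*ʳ (finList k) a f) (reflexive (Eq.sym (ΣFin≡Σl k _))))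

  -- The coefficient function of the linear form Σ_b x_b X_b, and convolution with it:
  -- multiplying by the linear form shifts the coefficients along the unit vectors.

  linForm : ∀ {k} → (Fin k → Carrier) → Vec ℕ k → Carrier
  linForm {k} x u = ΣFin k (λ b → x b * δ (unit b) u)

  conv-linForm : ∀ {k} m (x : Fin k → Carrier) (g : Vec ℕ k → Carrier) v →
                 conv 1 m (linForm x) g v ≈ ΣFin k (λ b → x b * ΣV m k (λ w → g w * δ (unit b ⊕ w) v))
  conv-linForm {k} m x g v = begin
    Σl (V1) (λ u → Σl (Vm) (λ w → linForm x u * g w * δ (u ⊕ w) v))
      ≈⟨ Σl-cong V1 (λ u → trans (Σl-cong Vm (λ w → *-assoc _ _ _)) (sym (Σl-*ˡ Vm (linForm x u) _))) ⟩
    Σl V1 (λ u → linForm x u * Z u)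
      ≈⟨ Σl-cong V1 (λ u → trans (*-cong (reflexive (ΣFin≡Σl k _)) ≈-refl)
            (trans (Σl-*ʳ (finList k) (Z u) _) (Σl-cong (finList k) (λ b → pull-δ (x b) (δ (unit b) u) (Z u))))) ⟩
    Σl V1 (λ u → Σl (finList k) (λ b → δ (unit b) u * (x b * Z u)))
      ≈⟨ Σl-swap V1 (finList k) _ ⟩
    Σl (finList k) (λ b → Σl V1 (λ u → δ (unit b) u * (x b * Z u)))
      ≈⟨ Σl-cong (finList k) (λ b → ΣV-δ′ 1 (unit b) (vsum-unit b) (λ u → x b * Z u)) ⟩
    Σl (finList k) (λ b → x b * Z (unit b))
      ≡⟨ Eq.sym (ΣFin≡Σl k _) ⟩
    ΣFin k (λ b → x b * ΣV m k (λ w → g w * δ (unit b ⊕ w) v)) ∎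
    where
    V1 = compositions 1 k
    Vm = compositions m k
    Z : Vec ℕ k → Carrier
    Z u = ΣV m k (λ w → g w * δ (u ⊕ w) v)
    pull-δ : ∀ a d z → a * d * z ≈ d * (a * z)
    pull-δ = solve 3 (λ a d z → a :* d :* z := d :* (a :* z)) ≈-refl

  ifPosR : ℕ → Carrier → Carrier
  ifPosR zero    _ = 0#
  ifPosR (suc _) y = y

  ofℕ-ifPos : ∀ n y → ofℕ (ifPos n y) ≈ ifPosR n (ofℕ y)
  ofℕ-ifPos zero    y = ≈-refl
  ofℕ-ifPos (suc n) y = ≈-refl

  ofℕ-ΣFℕ : ∀ k (f : Fin k → ℕ) → ofℕ (ΣFℕ k f) ≈ ΣFin k (λ b → ofℕ (f b))
  ofℕ-ΣFℕ zero    f = ≈-refl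
  ofℕ-ΣFℕ (suc k) f = trans (ofℕ-+ (f F.zero) _) (+-cong ≈-refl (ofℕ-ΣFℕ k (λ b → f (F.suc b))))

  -- The only w of degree m with e_b + w = v is v - e_b, which exists iff v_b > 0.
  ΣV-shift : ∀ {k} m (b : Fin k) (v : Vec ℕ k) → vsum v ≡ suc m → (g : Vec ℕ k → Carrier) →
             ΣV m k (λ w → g w * δ (unit b ⊕ w) v) ≈ ifPosR (lookup v b) (g (v ⊖ b))
  ΣV-shift {k} m b v ev g with lookup v b in eqb
  ... | zero  = trans (Σl-cong (compositions m k) (λ w → trans (*-cong ≈-refl (δ-no (unit b ⊕ w) v (no-preimage w))) (zeroʳ _)))
                      (Σl-0 (compositions m k))
    where
    no-preimage : ∀ w → unit b ⊕ w ≢ v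
    no-preimage w q with Eq.trans (Eq.sym (lookup-unit⊕ b w)) (Eq.trans (cong (λ z → lookup z b) q) eqb)
    ... | ()
  ... | suc t = trans (Σl-cong (compositions m k) (λ w → trans (*-cong ≈-refl (δ-shift w)) (*-comm _ _)))
                      (ΣV-δ m (v ⊖ b) (Eq.trans (vsum-⊖ v b eqb) (cong pred ev)) g)
    where
    δ-shift : ∀ w → δ (unit b ⊕ w) v ≈ δ w (v ⊖ b)
    δ-shift w = by-cases (≡-dec _≟_ w (v ⊖ b))
      where
      by-cases : Dec (w ≡ v ⊖ b) → δ (unit b ⊕ w) v ≈ δ w (v ⊖ b)
      by-cases (yes p) = trans (δ-yes _ _ (Eq.trans (cong (unit b ⊕_) p) (Eq.sym (unit⊕⊖ v b eqb)))) (sym (δ-yes _ _ p))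
      by-cases (no ¬p) = trans (δ-no _ _ (λ q → ¬p (⊕-cancelˡ (unit b) w (v ⊖ b) (Eq.trans q (unit⊕⊖ v b eqb)))))
                               (sym (δ-no _ _ ¬p))

  monomialRow-⊖ : ∀ {k} (x : Fin k → Carrier) (v : Vec ℕ k) (b : Fin k) {t} → lookup v b ≡ suc t →
                  x b * monomialRow x (v ⊖ b) ≈ monomialRow x v
  monomialRow-⊖ x (suc t ∷ ys) F.zero    refl = sym (*-assoc _ _ _)
  monomialRow-⊖ x (y ∷ ys)     (F.suc b) eq   =
    trans (exchange (x (F.suc b)) (pow (x F.zero) y) (monomialRow (λ b' → x (F.suc b')) (ys ⊖ b)))
          (*-cong ≈-refl (monomialRow-⊖ (λ b' → x (F.suc b')) ys b eq))
    where
    exchange : ∀ a b c → a * (b * c) ≈ b * (a * c)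
    exchange = solve 3 (λ a b c → a :* (b :* c) := b :* (a :* c)) ≈-refl

  -- (Σ_b x_b X_b) · (Σ_b x_b X_b)^m = (Σ_b x_b X_b)^{m+1}, coefficientwise: Pascal's rule.
  rowCoeff-pascal : ∀ {k} (x : Fin k → Carrier) (v : Vec ℕ k) m → vsum v ≡ suc m →
                    conv 1 m (linForm x) (rowCoeff x) v ≈ rowCoeff x v
  rowCoeff-pascal {k} x v m ev = begin
    conv 1 m (linForm x) (rowCoeff x) v
      ≈⟨ conv-linForm m x (rowCoeff x) v ⟩
    ΣFin k (λ b → x b * ΣV m k (λ w → rowCoeff x w * δ (unit b ⊕ w) v))
      ≈⟨ ΣFin-cong k (λ b → *-cong ≈-refl (ΣV-shift m b v ev (rowCoeff x))) ⟩
    ΣFin k (λ b → x b * ifPosR (lookup v b) (rowCoeff x (v ⊖ b)))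
      ≈⟨ ΣFin-cong k (λ b → factor-monomial b) ⟩
    ΣFin k (λ b → ifPosR (lookup v b) (ofℕ (multinomial (v ⊖ b))) * monomialRow x v)
      ≈⟨ sym (ΣFin-*ʳ k _ (monomialRow x v)) ⟩
    ΣFin k (λ b → ifPosR (lookup v b) (ofℕ (multinomial (v ⊖ b)))) * monomialRow x v
      ≈⟨ *-cong (trans (ΣFin-cong k (λ b → sym (ofℕ-ifPos (lookup v b) (multinomial (v ⊖ b))))) (sym (ofℕ-ΣFℕ k _))) ≈-refl ⟩
    ofℕ (ΣFℕ k (λ b → ifPos (lookup v b) (multinomial (v ⊖ b)))) * monomialRow x v
      ≡⟨ cong (λ z → ofℕ z * monomialRow x v) (multinomial-pascal v m ev) ⟩
    rowCoeff x v ∎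
    where
    factor-monomial : ∀ b → x b * ifPosR (lookup v b) (rowCoeff x (v ⊖ b))
                            ≈ ifPosR (lookup v b) (ofℕ (multinomial (v ⊖ b))) * monomialRow x v
    factor-monomial b with lookup v b in eqb
    ... | zero  = trans (zeroʳ _) (sym (zeroˡ _))
    ... | suc t = trans (exchange (x b) (ofℕ (multinomial (v ⊖ b))) (monomialRow x (v ⊖ b)))
                        (*-cong ≈-refl (monomialRow-⊖ x v b eqb))
      where
      exchange : ∀ a o r → a * (o * r) ≈ o * (a * r)
      exchange = solve 3 (λ a o r → a :* (o :* r) := o :* (a :* r)) ≈-refl

  conv-rotate : ∀ {k} d1 d3 (f l g : Vec ℕ k → Carrier) p →
                conv d1 (suc d3) f (conv 1 d3 l g) p ≈ conv 1 (d1 +ℕ d3) l (conv d1 d3 f g) p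
  conv-rotate {k} d1 d3 f l g p = begin
    conv d1 (1 +ℕ d3) f (conv 1 d3 l g) p
      ≈⟨ sym (conv-assoc d1 1 d3 f l g p) ⟩
    conv (d1 +ℕ 1) d3 (conv d1 1 f l) g p
      ≈⟨ conv-cong (d1 +ℕ 1) d3 (λ u _ → conv-comm d1 1 f l u) (λ _ _ → ≈-refl) p ⟩
    conv (d1 +ℕ 1) d3 (conv 1 d1 l f) g p
      ≡⟨ cong (λ d → conv d d3 (conv 1 d1 l f) g p) (NP.+-comm d1 1) ⟩
    conv (1 +ℕ d1) d3 (conv 1 d1 l f) g p
      ≈⟨ conv-assoc 1 d1 d3 l f g p ⟩
    conv 1 (d1 +ℕ d3) l (conv d1 d3 f g) p ∎

  prodCoeff-unit : ∀ {m k} (A : Fin m → Fin k → Carrier) (a : Fin m) (s : Vec ℕ m) p →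
                   prodCoeff A (unit a ⊕ s) p ≈ conv 1 (vsum s) (linForm (A a)) (prodCoeff A s) p
  prodCoeff-unit {suc m} {k} A F.zero (s0 ∷ ss) p rewrite zeros-⊕ ss =
    trans (conv-cong (suc s0) (vsum ss) (λ u eu → sym (rowCoeff-pascal (A F.zero) u s0 eu)) (λ _ _ → ≈-refl) p)
          (conv-assoc 1 s0 (vsum ss) (linForm (A F.zero)) (rowCoeff (A F.zero)) (prodCoeff (λ a → A (F.suc a)) ss) p)
  prodCoeff-unit {suc m} {k} A (F.suc a) (s0 ∷ ss) p = begin
    conv s0 (vsum (unit a ⊕ ss)) (rowCoeff (A F.zero)) (prodCoeff A' (unit a ⊕ ss)) p
      ≡⟨ cong (λ d → conv s0 d (rowCoeff (A F.zero)) (prodCoeff A' (unit a ⊕ ss)) p) (vsum-unit⊕ a ss) ⟩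
    conv s0 (suc (vsum ss)) (rowCoeff (A F.zero)) (prodCoeff A' (unit a ⊕ ss)) p
      ≈⟨ conv-cong s0 (suc (vsum ss)) (λ _ _ → ≈-refl) (λ w _ → prodCoeff-unit A' a ss w) p ⟩
    conv s0 (suc (vsum ss)) (rowCoeff (A F.zero)) (conv 1 (vsum ss) (linForm (A' a)) (prodCoeff A' ss)) p
      ≈⟨ conv-rotate s0 (vsum ss) (rowCoeff (A F.zero)) (linForm (A' a)) (prodCoeff A' ss) p ⟩
    conv 1 (s0 +ℕ vsum ss) (linForm (A' a)) (prodCoeff A (s0 ∷ ss)) p ∎
    where
    A' : Fin m → Fin k → Carrier
    A' b = A (F.suc b)

  prodCoeff-unit-expanded : ∀ {m k} (A : Fin m → Fin k → Carrier) (a : Fin m) (s : Vec ℕ m) n → vsum s ≡ n → ∀ v →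
    prodCoeff A (unit a ⊕ s) v ≈ ΣFin k (λ b → A a b * ΣV n k (λ w → prodCoeff A s w * δ (unit b ⊕ w) v))
  prodCoeff-unit-expanded A a s n refl v = trans (prodCoeff-unit A a s v) (conv-linForm (vsum s) (A a) (prodCoeff A s) v)

  prodCoeff-zeros : ∀ {m k} (A : Fin m → Fin k → Carrier) p → prodCoeff A (zeros m) p ≈ δ (zeros k) p
  prodCoeff-zeros {zero}      A p = ≈-refl
  prodCoeff-zeros {suc m} {k} A p = begin
    conv 0 (vsum (zeros m)) (rowCoeff (A F.zero)) (prodCoeff A' (zeros m)) p
      ≡⟨ cong (λ d → conv 0 d (rowCoeff (A F.zero)) (prodCoeff A' (zeros m)) p) (vsum-zeros m) ⟩
    conv 0 0 (rowCoeff (A F.zero)) (prodCoeff A' (zeros m)) p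
      ≈⟨ conv-zeros (rowCoeff (A F.zero)) (prodCoeff A' (zeros m)) p ⟩
    rowCoeff (A F.zero) (zeros k) * prodCoeff A' (zeros m) (zeros k) * δ (zeros k) p
      ≈⟨ *-cong (*-cong (rowCoeff-zeros (A F.zero)) (trans (prodCoeff-zeros A' (zeros k)) (δ-yes (zeros k) (zeros k) refl))) ≈-refl ⟩
    1# * 1# * δ (zeros k) p
      ≈⟨ trans (*-cong (*-identityˡ _) ≈-refl) (*-identityˡ _) ⟩
    δ (zeros k) p ∎
    where
    A' : Fin m → Fin k → Carrier
    A' b = A (F.suc b)
    rowCoeff-zeros : ∀ {k} (x : Fin k → Carrier) → rowCoeff x (zeros k) ≈ 1#
    rowCoeff-zeros {zero}  x = trans (*-identityʳ _) (+-identityʳ _)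
    rowCoeff-zeros {suc k} x =
      trans (*-cong (reflexive (cong ofℕ (NP.+-identityʳ (multinomial (zeros k))))) (*-identityˡ _)) (rowCoeff-zeros (λ b → x (F.suc b)))

  Σ-pull-inside : ∀ {a b d} {I : Set a} {B : Set b} {W : Set d} (is : List I) (bs : List B) (ws : List W)
                    (x : B → Carrier) (g : W → Carrier) (D : B → W → I → Carrier) (h : I → Carrier) →
                  Σl is (λ i → Σl bs (λ b → x b * Σl ws (λ w → g w * D b w i)) * h i)
                    ≈ Σl bs (λ b → x b * Σl ws (λ w → g w * Σl is (λ i → D b w i * h i)))
  Σ-pull-inside is bs ws x g D h = begin
    Σl is (λ i → Σl bs (λ b → x b * Σl ws (λ w → g w * D b w i)) * h i)
      ≈⟨ Σl-cong is (λ i → trans (Σl-*ʳ bs (h i) _) (Σl-cong bs (λ b → trans (*-assoc _ _ _)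
            (*-cong ≈-refl (trans (Σl-*ʳ ws (h i) _) (Σl-cong ws (λ w → *-assoc _ _ _))))))) ⟩
    Σl is (λ i → Σl bs (λ b → x b * Σl ws (λ w → g w * (D b w i * h i))))
      ≈⟨ Σl-swap is bs _ ⟩
    Σl bs (λ b → Σl is (λ i → x b * Σl ws (λ w → g w * (D b w i * h i))))
      ≈⟨ Σl-cong bs (λ b → trans (sym (Σl-*ˡ is (x b) _)) (*-cong ≈-refl
            (trans (Σl-swap is ws _) (Σl-cong ws (λ w → sym (Σl-*ˡ is (g w) _)))))) ⟩
    Σl bs (λ b → x b * Σl ws (λ w → g w * Σl is (λ i → D b w i * h i))) ∎

  Σ-regroup : ∀ {a b d e} {B : Set a} {W : Set b} {C : Set d} {L : Set e}
                (bs : List B) (ws : List W) (cs : List C) (ls : List L)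
                (x : B → Carrier) (g : W → Carrier) (Y : B → C → Carrier) (H : W → L → Carrier) (D : C → L → Carrier) →
              Σl bs (λ b → x b * Σl ws (λ w → g w * Σl cs (λ c → Y b c * Σl ls (λ l → H w l * D c l))))
                ≈ Σl cs (λ c → Σl bs (λ b → x b * Y b c) * Σl ls (λ l → Σl ws (λ w → g w * H w l) * D c l))
  Σ-regroup bs ws cs ls x g Y H D = begin
    Σl bs (λ b → x b * Σl ws (λ w → g w * Σl cs (λ c → Y b c * Σl ls (λ l → H w l * D c l))))
      ≈⟨ Σl-cong bs (λ b → trans (Σl-*ˡ ws (x b) _) (Σl-cong ws (λ w → trans (*-cong ≈-refl (Σl-*ˡ cs (g w) _))
            (trans (Σl-*ˡ cs _ _) (Σl-cong cs (λ c → trans (*-cong ≈-refl (*-cong ≈-refl (Σl-*ˡ ls (Y b c) _)))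
            (trans (*-cong ≈-refl (Σl-*ˡ ls (g w) _)) (Σl-*ˡ ls (x b) _)))))))) ⟩
    Σl bs (λ b → Σl ws (λ w → Σl cs (λ c → Σl ls (λ l → x b * (g w * (Y b c * (H w l * D c l)))))))
      ≈⟨ trans (Σl-cong bs (λ b → trans (Σl-swap ws cs _) (Σl-cong cs (λ c → Σl-swap ws ls _))))
         (trans (Σl-swap bs cs _) (Σl-cong cs (λ c → Σl-swap bs ls _))) ⟩
    Σl cs (λ c → Σl ls (λ l → Σl bs (λ b → Σl ws (λ w → x b * (g w * (Y b c * (H w l * D c l)))))))
      ≈⟨ Σl-cong cs (λ c → Σl-cong ls (λ l → Σl-cong bs (λ b → Σl-cong ws (λ w → regroup (x b) (g w) (Y b c) (H w l) (D c l))))) ⟩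
    Σl cs (λ c → Σl ls (λ l → Σl bs (λ b → Σl ws (λ w → x b * Y b c * (g w * H w l * D c l)))))
      ≈⟨ Σl-cong cs (λ c → Σl-cong ls (λ l → trans (Σl-cong bs (λ b → sym (Σl-*ˡ ws (x b * Y b c) _)))
            (trans (sym (Σl-*ʳ bs _ _)) (*-cong ≈-refl (sym (Σl-*ʳ ws (D c l) _)))))) ⟩
    Σl cs (λ c → Σl ls (λ l → Σl bs (λ b → x b * Y b c) * (Σl ws (λ w → g w * H w l) * D c l)))
      ≈⟨ Σl-cong cs (λ c → sym (Σl-*ˡ ls _ _)) ⟩
    Σl cs (λ c → Σl bs (λ b → x b * Y b c) * Σl ls (λ l → Σl ws (λ w → g w * H w l) * D c l)) ∎
    where
    regroup : ∀ x g y h d → x * (g * (y * (h * d))) ≈ x * y * (g * h * d)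
    regroup = solve 5 (λ x g y h d → x :* (g :* (y :* (h :* d))) := x :* y :* (g :* h :* d)) ≈-refl

  _·ₘ_ : ∀ {k} → Matrix k → Matrix k → Matrix k
  (A ·ₘ B) i j = ΣFin _ (λ t → A i t * B t j)

  prodCoeff-unit-pairing : ∀ {m k} (A : Fin m → Fin k → Carrier) (a : Fin m) (s : Vec ℕ m) n → vsum s ≡ n →
    (h : Vec ℕ k → Carrier) →
    ΣV (suc n) k (λ i → prodCoeff A (unit a ⊕ s) i * h i)
      ≈ ΣFin k (λ b → A a b * ΣV n k (λ w → prodCoeff A s w * h (unit b ⊕ w)))
  prodCoeff-unit-pairing {k = k} A a s n es h = begin
    ΣV (suc n) k (λ i → prodCoeff A (unit a ⊕ s) i * h i)
      ≈⟨ Σl-cong (compositions (suc n) k) (λ i → *-cong (trans (prodCoeff-unit-expanded A a s n es i) (reflexive (ΣFin≡Σl k _))) ≈-refl) ⟩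
    Σl (compositions (suc n) k) (λ i → Σl (finList k) (λ b → A a b * ΣV n k (λ w → prodCoeff A s w * δ (unit b ⊕ w) i)) * h i)
      ≈⟨ Σ-pull-inside (compositions (suc n) k) (finList k) (compositions n k) (A a) (prodCoeff A s) (λ b w i → δ (unit b ⊕ w) i) h ⟩
    Σl (finList k) (λ b → A a b * ΣV n k (λ w → prodCoeff A s w * ΣV (suc n) k (λ i → δ (unit b ⊕ w) i * h i)))
      ≈⟨ Σl-cong (finList k) (λ b → *-cong ≈-refl (ΣV-cong n k (λ w ew → *-cong ≈-refl
            (ΣV-δ′ (suc n) (unit b ⊕ w) (Eq.trans (vsum-unit⊕ b w) (cong suc ew)) h)))) ⟩
    Σl (finList k) (λ b → A a b * ΣV n k (λ w → prodCoeff A s w * h (unit b ⊕ w)))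
      ≡⟨ Eq.sym (ΣFin≡Σl k _) ⟩
    ΣFin k (λ b → A a b * ΣV n k (λ w → prodCoeff A s w * h (unit b ⊕ w))) ∎

  prodCoeff-multiplicative : ∀ {k} (A B : Matrix k) n (s : Vec ℕ k) → vsum s ≡ n → ∀ l →
    ΣV n k (λ i → prodCoeff A s i * prodCoeff B i l) ≈ prodCoeff (A ·ₘ B) s l
  prodCoeff-multiplicative {k} A B = unit-induction Statement base step
    where
    Statement : ℕ → Vec ℕ k → Set ℓ'
    Statement n s = ∀ l → ΣV n k (λ i → prodCoeff A s i * prodCoeff B i l) ≈ prodCoeff (A ·ₘ B) s l
    base : Statement 0 (zeros k)
    base l = begin
      ΣV 0 k (λ i → prodCoeff A (zeros k) i * prodCoeff B i l)
        ≈⟨ Σl-cong (compositions 0 k) (λ i → *-cong (prodCoeff-zeros A i) ≈-refl) ⟩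
      ΣV 0 k (λ i → δ (zeros k) i * prodCoeff B i l)
        ≈⟨ ΣV-δ′ 0 (zeros k) (vsum-zeros k) (λ i → prodCoeff B i l) ⟩
      prodCoeff B (zeros k) l
        ≈⟨ trans (prodCoeff-zeros B l) (sym (prodCoeff-zeros (A ·ₘ B) l)) ⟩
      prodCoeff (A ·ₘ B) (zeros k) l ∎
    step : ∀ n a s → vsum s ≡ n → Statement n s → Statement (suc n) (unit a ⊕ s)
    step n a s es ih l = begin
      ΣV (suc n) k (λ i → prodCoeff A (unit a ⊕ s) i * prodCoeff B i l)
        ≈⟨ prodCoeff-unit-pairing A a s n es (λ i → prodCoeff B i l) ⟩
      ΣFin k (λ b → A a b * ΣV n k (λ w → prodCoeff A s w * prodCoeff B (unit b ⊕ w) l))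
        ≈⟨ ΣFin-cong k (λ b → *-cong ≈-refl (ΣV-cong n k (λ w ew → *-cong ≈-refl
              (trans (prodCoeff-unit-expanded B b w n ew l) (reflexive (ΣFin≡Σl k _)))))) ⟩
      ΣFin k (λ b → A a b * ΣV n k (λ w → prodCoeff A s w * Σl (finList k) (λ c → B b c * ΣV n k (λ l' → prodCoeff B w l' * D c l'))))
        ≈⟨ trans (reflexive (ΣFin≡Σl k _)) (Σ-regroup (finList k) (compositions n k) (finList k) (compositions n k)
              (A a) (prodCoeff A s) B (prodCoeff B) D) ⟩
      Σl (finList k) (λ c → Σl (finList k) (λ b → A a b * B b c) * ΣV n k (λ l' → ΣV n k (λ w → prodCoeff A s w * prodCoeff B w l') * D c l'))
        ≈⟨ Σl-cong (finList k) (λ c → *-cong (reflexive (Eq.sym (ΣFin≡Σl k _))) (Σl-cong (compositions n k) (λ l' → *-cong (ih l') ≈-refl))) ⟩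
      Σl (finList k) (λ c → (A ·ₘ B) a c * ΣV n k (λ l' → prodCoeff (A ·ₘ B) s l' * D c l'))
        ≈⟨ trans (reflexive (Eq.sym (ΣFin≡Σl k _))) (sym (prodCoeff-unit-expanded (A ·ₘ B) a s n es l)) ⟩
      prodCoeff (A ·ₘ B) (unit a ⊕ s) l ∎
      where
      D : Fin k → Vec ℕ k → Carrier
      D c l' = δ (unit c ⊕ l') l

  -- Characters: χ(0) = 1 and χ(e_a + s) = c_a χ(s), i.e. χ(s) = ∏_a c_a^{s_a}.

  record IsCharacter {k} (c : Fin k → Carrier) (χ : Vec ℕ k → Carrier) : Set ℓ' where
    field
      χ-zeros : χ (zeros k) ≈ 1#
      χ-unit  : ∀ a s → χ (unit a ⊕ s) ≈ c a * χ s

  diagM : ∀ {k} → (Fin k → Carrier) → Matrix k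
  diagM c i j = if ⌊ i F.≟ j ⌋ then c i else 0#

  ΣFin-diagM : ∀ {k} (c : Fin k → Carrier) (a : Fin k) (X : Fin k → Carrier) → ΣFin k (λ b → diagM c a b * X b) ≈ c a * X a
  ΣFin-diagM {suc k} c F.zero    X = trans (+-cong ≈-refl (trans (ΣFin-cong k (λ b → zeroˡ _)) (ΣFin-0 k))) (+-identityʳ _)
    where
    ΣFin-0 : ∀ k → ΣFin k (λ _ → 0#) ≈ 0#
    ΣFin-0 zero    = ≈-refl
    ΣFin-0 (suc k) = trans (+-identityˡ _) (ΣFin-0 k)
  ΣFin-diagM {suc k} c (F.suc a) X =
    trans (+-cong (zeroˡ _) ≈-refl) (trans (+-identityˡ _)
      (trans (ΣFin-cong k (λ b → reflexive (cong (λ t → (if t then c (F.suc a) else 0#) * X (F.suc b)) (suc≟suc a b))))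
             (ΣFin-diagM (λ i → c (F.suc i)) a (λ b → X (F.suc b)))))
    where
    suc≟suc : ∀ {k} (a b : Fin k) → ⌊ F.suc a F.≟ F.suc b ⌋ ≡ ⌊ a F.≟ b ⌋
    suc≟suc a b with a F.≟ b
    ... | yes _ = refl
    ... | no _  = refl

  prodCoeff-diagonal : ∀ {k} {c : Fin k → Carrier} {χ : Vec ℕ k → Carrier} → IsCharacter c χ →
                       ∀ n s → vsum s ≡ n → ∀ l → prodCoeff (diagM c) s l ≈ δ s l * χ s
  prodCoeff-diagonal {k} {c} {χ} isχ = unit-induction Statement base step
    where
    open IsCharacter isχ
    Statement : ℕ → Vec ℕ k → Set ℓ'
    Statement n s = ∀ l → prodCoeff (diagM c) s l ≈ δ s l * χ s
    base : Statement 0 (zeros k)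
    base l = trans (prodCoeff-zeros (diagM c) l) (trans (sym (*-identityʳ _)) (*-cong ≈-refl (sym χ-zeros)))
    step : ∀ n a s → vsum s ≡ n → Statement n s → Statement (suc n) (unit a ⊕ s)
    step n a s es ih l = begin
      prodCoeff (diagM c) (unit a ⊕ s) l
        ≈⟨ prodCoeff-unit-expanded (diagM c) a s n es l ⟩
      ΣFin k (λ b → diagM c a b * ΣV n k (λ w → prodCoeff (diagM c) s w * δ (unit b ⊕ w) l))
        ≈⟨ ΣFin-cong k (λ b → *-cong ≈-refl (trans (ΣV-cong n k (λ w _ → trans (*-cong (ih w) ≈-refl) (*-assoc _ _ _)))
                                                   (ΣV-δ′ n s es (λ w → χ s * δ (unit b ⊕ w) l)))) ⟩
      ΣFin k (λ b → diagM c a b * (χ s * δ (unit b ⊕ s) l))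
        ≈⟨ ΣFin-diagM c a (λ b → χ s * δ (unit b ⊕ s) l) ⟩
      c a * (χ s * δ (unit a ⊕ s) l)
        ≈⟨ trans (rotate (c a) (χ s) (δ (unit a ⊕ s) l)) (*-cong ≈-refl (sym (χ-unit a s))) ⟩
      δ (unit a ⊕ s) l * χ (unit a ⊕ s) ∎
      where
      rotate : ∀ x y z → x * (y * z) ≈ z * (x * y)
      rotate = solve 3 (λ x y z → x :* (y :* z) := z :* (x :* y)) ≈-refl

  rowScale : ∀ {k} → (Fin k → Carrier) → Matrix k → Matrix k
  rowScale d B i j = d i * B i j

  prodCoeff-rowScale : ∀ {k} {d : Fin k → Carrier} {ψ : Vec ℕ k → Carrier} → IsCharacter d ψ → (B : Matrix k) →
                       ∀ n s → vsum s ≡ n → ∀ l → prodCoeff (rowScale d B) s l ≈ ψ s * prodCoeff B s l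
  prodCoeff-rowScale {k} {d} {ψ} isψ B = unit-induction Statement base step
    where
    open IsCharacter isψ renaming (χ-zeros to ψ-zeros; χ-unit to ψ-unit)
    Statement : ℕ → Vec ℕ k → Set ℓ'
    Statement n s = ∀ l → prodCoeff (rowScale d B) s l ≈ ψ s * prodCoeff B s l
    base : Statement 0 (zeros k)
    base l = trans (prodCoeff-zeros (rowScale d B) l)
                   (trans (sym (*-identityˡ _)) (*-cong (sym ψ-zeros) (sym (prodCoeff-zeros B l))))
    step : ∀ n a s → vsum s ≡ n → Statement n s → Statement (suc n) (unit a ⊕ s)
    step n a s _ ih l = begin
      prodCoeff (rowScale d B) (unit a ⊕ s) l
        ≈⟨ prodCoeff-unit (rowScale d B) a s l ⟩
      conv 1 (vsum s) (linForm (rowScale d B a)) (prodCoeff (rowScale d B) s) l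
        ≈⟨ conv-cong 1 (vsum s) (λ u _ → trans (ΣFin-cong k (λ b → *-assoc _ _ _)) (sym (ΣFin-*ˡ k (d a) _))) (λ w _ → ih w) l ⟩
      conv 1 (vsum s) (λ u → d a * linForm (B a) u) (λ w → ψ s * prodCoeff B s w) l
        ≈⟨ trans (conv-scaleˡ 1 (vsum s) (d a) (linForm (B a)) _ l) (*-cong ≈-refl (conv-scaleʳ 1 (vsum s) (ψ s) (linForm (B a)) (prodCoeff B s) l)) ⟩
      d a * (ψ s * conv 1 (vsum s) (linForm (B a)) (prodCoeff B s) l)
        ≈⟨ trans (sym (*-assoc _ _ _)) (*-cong (sym (ψ-unit a s)) (sym (prodCoeff-unit B a s l))) ⟩
      ψ (unit a ⊕ s) * prodCoeff B (unit a ⊕ s) l ∎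

  pow-cong : ∀ {x y} n → x ≈ y → pow x n ≈ pow y n
  pow-cong zero    _  = ≈-refl
  pow-cong (suc n) eq = *-cong eq (pow-cong n eq)

  monomialRow-cong : ∀ {k} {x y : Fin k → Carrier} → (∀ b → x b ≈ y b) → ∀ v → monomialRow x v ≈ monomialRow y v
  monomialRow-cong {zero}  eq []      = ≈-refl
  monomialRow-cong {suc k} eq (z ∷ v) = *-cong (pow-cong z (eq F.zero)) (monomialRow-cong (λ b → eq (F.suc b)) v)

  prodCoeff-cong : ∀ {m k} {A A' : Fin m → Fin k → Carrier} → (∀ i j → A i j ≈ A' i j) → ∀ s p → prodCoeff A s p ≈ prodCoeff A' s p
  prodCoeff-cong {zero}  eq []        p = ≈-refl
  prodCoeff-cong {suc m} eq (s0 ∷ ss) p =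
    conv-cong s0 (vsum ss) (λ u _ → *-cong ≈-refl (monomialRow-cong (eq F.zero) u)) (λ w _ → prodCoeff-cong (λ i j → eq (F.suc i) j) ss w) p

  conj-0 : conj 0# ≈ 0#
  conj-0 = RingProperties.x+x≈x⇒x≈0 (CommutativeRing.ring commRing) (conj 0#) (trans (sym (conj-+ 0# 0#)) (conj-cong (+-identityˡ 0#)))

  conj-Σl : ∀ {a} {A : Set a} (xs : List A) (f : A → Carrier) → conj (Σl xs f) ≈ Σl xs (λ x → conj (f x))
  conj-Σl []       f = conj-0
  conj-Σl (x ∷ xs) f = trans (conj-+ _ _) (+-cong ≈-refl (conj-Σl xs f))

  conj-Πl : ∀ {a} {A : Set a} (xs : List A) (f : A → Carrier) → conj (Πl xs f) ≈ Πl xs (λ x → conj (f x))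
  conj-Πl []       f = conj-1
  conj-Πl (x ∷ xs) f = trans (conj-* _ _) (*-cong ≈-refl (conj-Πl xs f))

  Πl-cong : ∀ {a} {A : Set a} (xs : List A) {f g : A → Carrier} → (∀ x → f x ≈ g x) → Πl xs f ≈ Πl xs g
  Πl-cong []       eq = ≈-refl
  Πl-cong (x ∷ xs) eq = *-cong (eq x) (Πl-cong xs eq)

  conj-ofℕ : ∀ n → conj (ofℕ n) ≈ ofℕ n
  conj-ofℕ zero    = conj-0
  conj-ofℕ (suc n) = trans (conj-+ _ _) (+-cong conj-1 (conj-ofℕ n))

  conj-pow : ∀ x n → conj (pow x n) ≈ pow (conj x) n
  conj-pow x zero    = conj-1
  conj-pow x (suc n) = trans (conj-* _ _) (*-cong ≈-refl (conj-pow x n))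

  conjM : ∀ {k} → Matrix k → Matrix k
  conjM G i j = conj (G i j)

  conj-MG : ∀ {k} (G : Matrix k) p s → conj (MG G p s) ≈ MG (conjM G) p s
  conj-MG {k} G p s = trans (conj-Σl (families p s) _) (Σl-cong (families p s) (λ r →
    trans (conj-* (ofℕ (famCoeff s r)) (monomial G r)) (*-cong (conj-ofℕ (famCoeff s r))
      (trans (conj-Πl Fins (λ a → Πl Fins (λ b → pow (G a b) (lookup (lookup r a) b))))
        (Πl-cong Fins (λ a → trans (conj-Πl Fins (λ b → pow (G a b) (lookup (lookup r a) b)))
                                   (Πl-cong Fins (λ b → conj-pow (G a b) (lookup (lookup r a) b)))))))))
    where
    Fins = toList (allFin k)

  MG-multiplicative : ∀ {k} (A B : Matrix k) n (s : Vec ℕ k) → vsum s ≡ n → ∀ l →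
                      ΣV n k (λ i → MG A i s * MG B l i) ≈ MG (A ·ₘ B) l s
  MG-multiplicative {k} A B n s es l =
    trans (Σl-cong (compositions n k) (λ i → *-cong (MG≈prodCoeff A i s) (MG≈prodCoeff B l i)))
          (trans (prodCoeff-multiplicative A B n s es l) (sym (MG≈prodCoeff (A ·ₘ B) l s)))

  MG-diagonal : ∀ {k} {c : Fin k → Carrier} {χ : Vec ℕ k → Carrier} → IsCharacter c χ →
                ∀ n s → vsum s ≡ n → ∀ l → MG (diagM c) l s ≈ δ s l * χ s
  MG-diagonal isχ n s es l = trans (MG≈prodCoeff _ l s) (prodCoeff-diagonal isχ n s es l)

  MG-rowScale : ∀ {k} {d : Fin k → Carrier} {ψ : Vec ℕ k → Carrier} → IsCharacter d ψ → (B : Matrix k) →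
                ∀ n s → vsum s ≡ n → ∀ l → MG (rowScale d B) l s ≈ ψ s * MG B l s
  MG-rowScale isψ B n s es l =
    trans (MG≈prodCoeff _ l s) (trans (prodCoeff-rowScale isψ B n s es l) (*-cong ≈-refl (sym (MG≈prodCoeff B l s))))

  MG-cong : ∀ {k} {A A' : Matrix k} → (∀ i j → A i j ≈ A' i j) → ∀ p s → MG A p s ≈ MG A' p s
  MG-cong {A = A} {A'} eq p s = trans (MG≈prodCoeff A p s) (trans (prodCoeff-cong eq s p) (sym (MG≈prodCoeff A' p s)))

  record IsRealSign {k} (d : Fin k → Carrier) : Set ℓ' where
    field
      sign-square : ∀ a → d a * d a ≈ 1#
      sign-real   : ∀ a → conj (d a) ≈ d a

  TwistedSymmetric : ∀ {k} → (Fin k → Carrier) → Matrix k → Set ℓ'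
  TwistedSymmetric d G = ∀ t j → G t j ≈ d t * (d j * G j t)

  degree-character : ∀ {k} (x : Carrier) → IsCharacter {k} (λ _ → x) (λ s → pow x (vsum s))
  degree-character {k} x = record
    { χ-zeros = reflexive (cong (pow x) (vsum-zeros k))
    ; χ-unit  = λ a s → reflexive (cong (pow x) (vsum-unit⊕ a s))
    }

  character-* : ∀ {k} {c c' : Fin k → Carrier} {χ χ' : Vec ℕ k → Carrier} → IsCharacter c χ → IsCharacter c' χ' →
                IsCharacter (λ a → c a * c' a) (λ s → χ s * χ' s)
  character-* isχ isχ' = record
    { χ-zeros = trans (*-cong (IsCharacter.χ-zeros isχ) (IsCharacter.χ-zeros isχ')) (*-identityˡ 1#)
    ; χ-unit  = λ a s → trans (*-cong (IsCharacter.χ-unit isχ a s) (IsCharacter.χ-unit isχ' a s))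
                              (interchange _ _ _ _)
    }
    where
    interchange : ∀ x y z w → x * y * (z * w) ≈ x * z * (y * w)
    interchange = solve 4 (λ x y z w → x :* y :* (z :* w) := x :* z :* (y :* w)) ≈-refl

  character-square : ∀ {k} {d : Fin k → Carrier} {ψ : Vec ℕ k → Carrier} → IsRealSign d → IsCharacter d ψ →
                     ∀ s → ψ s * ψ s ≈ 1#
  character-square {k} {d} {ψ} isd isψ s = unit-induction (λ _ s → ψ s * ψ s ≈ 1#) base step (vsum s) s refl
    where
    open IsCharacter isψ
    base : ψ (zeros k) * ψ (zeros k) ≈ 1#
    base = trans (*-cong χ-zeros χ-zeros) (*-identityˡ 1#)
    step : ∀ n a s → vsum s ≡ n → ψ s * ψ s ≈ 1# → ψ (unit a ⊕ s) * ψ (unit a ⊕ s) ≈ 1#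
    step _ a s _ ih = trans (*-cong (χ-unit a s) (χ-unit a s)) (trans (interchange _ _ _ _)
                        (trans (*-cong (IsRealSign.sign-square isd a) ih) (*-identityˡ 1#)))
      where
      interchange : ∀ x y z w → x * y * (z * w) ≈ x * z * (y * w)
      interchange = solve 4 (λ x y z w → x :* y :* (z :* w) := x :* z :* (y :* w)) ≈-refl

  module Twisted {k} (G : Matrix k) (hadamard : IsGenHadamard G) {d : Fin k → Carrier}
                 (isd : IsRealSign d) (twisted : TwistedSymmetric d G) where
    open IsRealSign isd

    Q : Carrier
    Q = ofℕ k

    scaled-identity : ∀ i j → d j * (if ⌊ i F.≟ j ⌋ then Q else 0#) ≈ diagM (λ a → Q * d a) i j
    scaled-identity i j with i F.≟ j
    ... | yes refl = *-comm _ _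
    ... | no _     = zeroʳ _

    identity-sym : ∀ (i j : Fin k) → (if ⌊ j F.≟ i ⌋ then Q else 0#) ≈ (if ⌊ i F.≟ j ⌋ then Q else 0#)
    identity-sym i j with i F.≟ j | j F.≟ i
    ... | yes _ | yes _ = ≈-refl
    ... | no _  | no _  = ≈-refl
    ... | yes p | no ¬p = ⊥-elim (¬p (Eq.sym p))
    ... | no ¬p | yes p = ⊥-elim (¬p (Eq.sym p))

    conj-twisted : ∀ t j → conj (G t j) ≈ d t * (d j * conj (G j t))
    conj-twisted t j = trans (conj-cong (twisted t j))
      (trans (conj-* _ _) (*-cong (sign-real t) (trans (conj-* _ _) (*-cong (sign-real j) ≈-refl))))

    -- a twisted entry times the cofactor: the two factors d_t cancel
    cancel-twist : ∀ t j (x y : Carrier) → x * (d t * (d t * (d j * y))) ≈ d j * (x * y)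
    cancel-twist t j x y = trans (regroup x (d t) (d j) y) (trans (*-cong (sign-square t) ≈-refl) (*-identityˡ _))
      where
      regroup : ∀ x dt dj y → x * (dt * (dt * (dj * y))) ≈ dt * dt * (dj * (x * y))
      regroup = solve 4 (λ x dt dj y → x :* (dt :* (dt :* (dj :* y))) := dt :* dt :* (dj :* (x :* y))) ≈-refl

    product-left : ∀ i j → (G ·ₘ rowScale d (conjM G)) i j ≈ diagM (λ a → Q * d a) i j
    product-left i j =
      trans (ΣFin-cong k (λ t → trans (*-cong ≈-refl (*-cong ≈-refl (conj-twisted t j))) (cancel-twist t j (G i t) (conj (G j t)))))
            (trans (sym (ΣFin-*ˡ k (d j) (λ t → G i t * conj (G j t)))) (trans (*-cong ≈-refl (hadamard i j)) (scaled-identity i j)))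

    product-right : ∀ i j → (conjM G ·ₘ rowScale d G) i j ≈ diagM (λ a → Q * d a) i j
    product-right i j =
      trans (ΣFin-cong k (λ t → trans (*-cong ≈-refl (*-cong ≈-refl (twisted t j)))
                                  (trans (cancel-twist t j (conj (G i t)) (G j t)) (*-cong ≈-refl (*-comm _ _)))))
            (trans (sym (ΣFin-*ˡ k (d j) (λ t → G j t * conj (G i t))))
                   (trans (*-cong ≈-refl (trans (hadamard j i) (identity-sym i j))) (scaled-identity i j)))

    module _ {ψ : Vec ℕ k → Carrier} (isψ : IsCharacter d ψ) (n : ℕ) where

      diagonal-value : ∀ s l → vsum s ≡ n → vsum l ≡ n → MG (diagM (λ a → Q * d a)) l s ≈ δ s l * (pow Q n * ψ l)
      diagonal-value s l es el =
        trans (MG-diagonal (character-* (degree-character Q) isψ) n s es l)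
              (trans (δ-subst s l (λ t → pow Q (vsum t) * ψ t)) (*-cong ≈-refl (*-cong (reflexive (cong (pow Q) el)) ≈-refl)))

      orthogonalityˡ : ∀ s l → vsum s ≡ n → vsum l ≡ n →
                       ΣV n k (λ i → MG G i s * (ψ i * conj (MG G l i))) ≈ δ s l * (pow Q n * ψ l)
      orthogonalityˡ s l es el = begin
        ΣV n k (λ i → MG G i s * (ψ i * conj (MG G l i)))
          ≈⟨ ΣV-cong n k (λ i ei → *-cong ≈-refl (trans (*-cong ≈-refl (conj-MG G l i)) (sym (MG-rowScale isψ (conjM G) n i ei l)))) ⟩
        ΣV n k (λ i → MG G i s * MG (rowScale d (conjM G)) l i)
          ≈⟨ MG-multiplicative G (rowScale d (conjM G)) n s es l ⟩
        MG (G ·ₘ rowScale d (conjM G)) l s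
          ≈⟨ MG-cong product-left l s ⟩
        MG (diagM (λ a → Q * d a)) l s
          ≈⟨ diagonal-value s l es el ⟩
        δ s l * (pow Q n * ψ l) ∎

      orthogonalityʳ : ∀ s l → vsum s ≡ n → vsum l ≡ n →
                       ΣV n k (λ i → MG G s i * (ψ i * conj (MG G i l))) ≈ δ s l * (pow Q n * ψ l)
      orthogonalityʳ s l es el = begin
        ΣV n k (λ i → MG G s i * (ψ i * conj (MG G i l)))
          ≈⟨ ΣV-cong n k (λ i ei → trans (exchange (MG G s i) (ψ i) (conj (MG G i l)))
               (*-cong (conj-MG G i l) (sym (MG-rowScale isψ G n i ei s)))) ⟩
        ΣV n k (λ i → MG (conjM G) i l * MG (rowScale d G) s i)
          ≈⟨ MG-multiplicative (conjM G) (rowScale d G) n l el s ⟩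
        MG (conjM G ·ₘ rowScale d G) s l
          ≈⟨ MG-cong product-right s l ⟩
        MG (diagM (λ a → Q * d a)) s l
          ≈⟨ diagonal-value l s el es ⟩
        δ l s * (pow Q n * ψ s)
          ≈⟨ trans (*-cong (δ-sym l s) ≈-refl) (δ-subst s l (λ t → pow Q n * ψ t)) ⟩
        δ s l * (pow Q n * ψ l) ∎
        where
        exchange : ∀ m w c → m * (w * c) ≈ c * (w * m)
        exchange = solve 3 (λ m w c → m :* (w :* c) := c :* (w :* m)) ≈-refl

  invert-expansion : ∀ {k} n (α γ : Vec ℕ k → Carrier) (P R : Vec ℕ k → Vec ℕ k → Carrier) (c w : Vec ℕ k → Carrier) →
    (∀ x → vsum x ≡ n → γ x ≈ ΣV n k (λ s → α s * P x s)) →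
    (∀ s l → vsum s ≡ n → vsum l ≡ n → ΣV n k (λ i → P i s * R l i) ≈ δ s l * c l) →
    ∀ l → vsum l ≡ n → w l * c l ≈ 1# → α l ≈ w l * ΣV n k (λ i → γ i * R l i)
  invert-expansion {k} n α γ P R c w expansion orthogonal l el wc≈1 = sym (begin
    w l * ΣV n k (λ i → γ i * R l i)
      ≈⟨ *-cong ≈-refl (ΣV-cong n k (λ i ei → *-cong (expansion i ei) ≈-refl)) ⟩
    w l * Σl Vn (λ i → Σl Vn (λ s → α s * P i s) * R l i)
      ≈⟨ *-cong ≈-refl (Σl-cong Vn (λ i → trans (Σl-*ʳ Vn (R l i) _) (Σl-cong Vn (λ s → *-assoc _ _ _)))) ⟩
    w l * Σl Vn (λ i → Σl Vn (λ s → α s * (P i s * R l i)))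
      ≈⟨ *-cong ≈-refl (trans (Σl-swap Vn Vn _) (Σl-cong Vn (λ s → sym (Σl-*ˡ Vn (α s) _)))) ⟩
    w l * Σl Vn (λ s → α s * ΣV n k (λ i → P i s * R l i))
      ≈⟨ *-cong ≈-refl (ΣV-cong n k (λ s es → trans (*-cong ≈-refl (orthogonal s l es el)) (exchange (α s) (δ s l) (c l)))) ⟩
    w l * Σl Vn (λ s → δ s l * (α s * c l))
      ≈⟨ *-cong ≈-refl (ΣV-δ n l el (λ s → α s * c l)) ⟩
    w l * (α l * c l)
      ≈⟨ trans (rotate (w l) (α l) (c l)) (trans (*-cong ≈-refl wc≈1) (*-identityʳ (α l))) ⟩
    α l ∎)
    where
    Vn = compositions n k
    exchange : ∀ a d c → a * (d * c) ≈ d * (a * c)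
    exchange = solve 3 (λ a d c → a :* (d :* c) := d :* (a :* c)) ≈-refl
    rotate : ∀ w a c → w * (a * c) ≈ a * (w * c)
    rotate = solve 3 (λ w a c → w :* (a :* c) := a :* (w :* c)) ≈-refl

  pow-inverse : ∀ x y n → x * y ≈ 1# → pow x n * pow y n ≈ 1#
  pow-inverse x y zero    _  = *-identityˡ _
  pow-inverse x y (suc n) xy = trans (interchange x (pow x n) y (pow y n)) (trans (*-cong xy (pow-inverse x y n xy)) (*-identityˡ _))
    where
    interchange : ∀ a b c d → a * b * (c * d) ≈ a * c * (b * d)
    interchange = solve 4 (λ a b c d → a :* b :* (c :* d) := a :* c :* (b :* d)) ≈-refl

  twisted-inversion : ∀ {k} n (qinv : Carrier) → ofℕ k * qinv ≈ 1# → (G : Matrix k) → IsGenHadamard G →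
    {d : Fin k → Carrier} {ψ : Vec ℕ k → Carrier} → IsRealSign d → IsCharacter d ψ → TwistedSymmetric d G →
    (γ : Vec ℕ k → Carrier) →
    ((α : Vec ℕ k → Carrier) → (∀ x → vsum x ≡ n → γ x ≈ ΣV n k (λ s → α s * MG G x s)) →
       ∀ l → vsum l ≡ n → α l ≈ ψ l * pow qinv n * ΣV n k (λ i → ψ i * γ i * conj (MG G l i)))
    ×
    ((β : Vec ℕ k → Carrier) → (∀ x → vsum x ≡ n → γ x ≈ ΣV n k (λ s → β s * MG G s x)) →
       ∀ l → vsum l ≡ n → β l ≈ ψ l * pow qinv n * ΣV n k (λ i → ψ i * γ i * conj (MG G i l)))
  twisted-inversion {k} n qinv inv G hadamard {d} {ψ} isd isψ twisted γ =
      (λ α expansion l el →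
         trans (invert-expansion n α γ (λ x s → MG G x s) (λ l i → ψ i * conj (MG G l i)) norm weight
                                 expansion (orthogonalityˡ isψ n) l el (weight·norm l))
               (weight-inside (λ i → conj (MG G l i))))
    , (λ β expansion l el →
         trans (invert-expansion n β γ (λ x s → MG G s x) (λ l i → ψ i * conj (MG G i l)) norm weight
                                 expansion (orthogonalityʳ isψ n) l el (weight·norm l))
               (weight-inside (λ i → conj (MG G i l))))
    where
    open Twisted G hadamard isd twisted
    norm weight : Vec ℕ k → Carrier
    norm l   = pow Q n * ψ l
    weight l = ψ l * pow qinv n
    weight·norm : ∀ l → weight l * norm l ≈ 1#
    weight·norm l = trans (interchange (ψ l) (pow qinv n) (pow Q n) (ψ l))
                      (trans (*-cong (character-square isd isψ l) (trans (*-comm _ _) (pow-inverse Q qinv n inv))) (*-identityˡ 1#))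
      where
      interchange : ∀ a b c d → a * b * (c * d) ≈ a * d * (b * c)
      interchange = solve 4 (λ a b c d → a :* b :* (c :* d) := a :* d :* (b :* c)) ≈-refl
    weight-inside : ∀ {l} (h : Vec ℕ k → Carrier) →
                    weight l * ΣV n k (λ i → γ i * (ψ i * h i)) ≈ weight l * ΣV n k (λ i → ψ i * γ i * h i)
    weight-inside h = *-cong ≈-refl (Σl-cong (compositions n k) (λ i → exchange (γ i) (ψ i) (h i)))
      where
      exchange : ∀ g w h → g * (w * h) ≈ w * g * h
      exchange = solve 3 (λ g w h → g :* (w :* h) := w :* g :* h) ≈-refl

  trivial-sign : ∀ {k} → IsRealSign {k} (λ _ → 1#)
  trivial-sign = record { sign-square = λ _ → *-identityˡ 1# ; sign-real = λ _ → conj-1 }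

  trivial-character : ∀ {k} → IsCharacter {k} (λ _ → 1#) (λ _ → 1#)
  trivial-character = record { χ-zeros = ≈-refl ; χ-unit = λ _ _ → sym (*-identityˡ 1#) }

  symmetric⇒twisted : ∀ {k} {G : Matrix k} → IsSymmetric G → TwistedSymmetric (λ _ → 1#) G
  symmetric⇒twisted symmetric t j = trans (symmetric t j) (sym (trans (*-identityˡ _) (*-identityˡ _)))

  drop-trivial-weight : ∀ {k} n {a : Vec ℕ k → Carrier} {x : Carrier} (g : Vec ℕ k → Carrier) (h : Vec ℕ k → Vec ℕ k → Carrier) →
                        (∀ l → vsum l ≡ n → a l ≈ 1# * x * ΣV n k (λ i → 1# * g i * h l i)) →
                        ∀ l → vsum l ≡ n → a l ≈ x * ΣV n k (λ i → g i * h l i)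
  drop-trivial-weight {k} n {x = x} g h weighted l el =
    trans (weighted l el) (*-cong (*-identityˡ x) (Σl-cong (compositions n k) (λ i → *-cong (*-identityˡ (g i)) ≈-refl)))

  -- Part (2): a normalized matrix with symmetric core is twisted-symmetric for d = (-1, 1, …, 1),
  -- whose character is s ↦ (-1)^{s_0}.

  firstSign : ∀ {k} → Fin k → Carrier
  firstSign F.zero    = - 1#
  firstSign (F.suc _) = 1#

  -1*-1 : - 1# * - 1# ≈ 1#
  -1*-1 = trans (-1*x≈-x (- 1#)) (-‿involutive 1#)

  conj-1≈-1 : conj (- 1#) ≈ - 1#
  conj-1≈-1 = RingProperties.+-inverseˡ-unique (CommutativeRing.ring commRing) (conj (- 1#)) 1#
    (trans (+-cong ≈-refl (sym conj-1)) (trans (sym (conj-+ _ _)) (trans (conj-cong (-‿inverseˡ 1#)) conj-0)))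

  firstSign-real : ∀ {k} → IsRealSign (firstSign {k})
  firstSign-real = record { sign-square = square ; sign-real = real }
    where
    square : ∀ {k} (a : Fin k) → firstSign a * firstSign a ≈ 1#
    square F.zero    = -1*-1
    square (F.suc _) = *-identityˡ 1#
    real : ∀ {k} (a : Fin k) → conj (firstSign a) ≈ firstSign a
    real F.zero    = conj-1≈-1
    real (F.suc _) = conj-1

  sign-entry0-character : ∀ {k} → IsCharacter {suc k} firstSign (λ s → sign (entry0 s))
  sign-entry0-character = record { χ-zeros = ≈-refl ; χ-unit = unit-case }
    where
    unit-case : ∀ {k} (a : Fin (suc k)) (s : Vec ℕ (suc k)) → sign (entry0 (unit a ⊕ s)) ≈ firstSign a * sign (entry0 s)
    unit-case F.zero    (x ∷ s) = ≈-refl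
    unit-case (F.suc a) (x ∷ s) = sym (*-identityˡ _)

  normalized⇒twisted : ∀ {k} {G : Matrix (suc k)} → CoreSym G → FirstRowOnes G → FirstColMinusOnes G →
                       TwistedSymmetric firstSign G
  normalized⇒twisted {G = G} core firstRow firstCol = twist
    where
    one : ∀ j → G F.zero j ≈ 1#
    one j = firstRow F.zero j refl
    minus-one : ∀ i → G (F.suc i) F.zero ≈ - 1#
    minus-one i = firstCol (F.suc i) F.zero (λ ()) refl
    twist : TwistedSymmetric firstSign G
    twist F.zero    F.zero    = sym (trans (sym (*-assoc _ _ _)) (trans (*-cong -1*-1 ≈-refl) (*-identityˡ _)))
    twist F.zero    (F.suc j) = trans (one (F.suc j)) (sym (trans (*-cong ≈-refl (trans (*-identityˡ _) (minus-one j))) -1*-1))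
    twist (F.suc t) F.zero    = trans (minus-one t) (sym (trans (*-identityˡ _) (trans (*-cong ≈-refl (one (F.suc t))) (*-identityʳ _))))
    twist (F.suc t) (F.suc j) = trans (core (F.suc t) (F.suc j) (λ ()) (λ ())) (sym (trans (*-identityˡ _) (*-identityˡ _)))

mainTheorem6 : ∀ {c ℓ'} (K : InvolutiveCommRing c ℓ') →
    let open InvolutiveCommRing K
        open WithRing K
    in (q n : ℕ) → 2 ≤ q →
       (qinv : Carrier) → ofℕ q * qinv ≈ 1# →
       (G : Matrix q) → IsGenHadamard G →
       (γ : Vec ℕ q → Carrier) →
       -- part (1): G symmetric
       (IsSymmetric G →
         ((α : Vec ℕ q → Carrier) →
           (∀ x → vsum x ≡ n → γ x ≈ ΣV n q (λ s → α s * MG G x s)) →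
           ∀ l → vsum l ≡ n →
             α l ≈ pow qinv n * ΣV n q (λ i → γ i * conj (MG G l i)))
         ×
         ((β : Vec ℕ q → Carrier) →
           (∀ x → vsum x ≡ n → γ x ≈ ΣV n q (λ s → β s * MG G s x)) →
           ∀ l → vsum l ≡ n →
             β l ≈ pow qinv n * ΣV n q (λ i → γ i * conj (MG G i l))))
       ×
       -- part (2): core symmetric, g_{0j} = 1, g_{i0} = -1 (i ≥ 1)
       (CoreSym G → FirstRowOnes G → FirstColMinusOnes G →
         ((α : Vec ℕ q → Carrier) →
           (∀ x → vsum x ≡ n → γ x ≈ ΣV n q (λ s → α s * MG G x s)) →
           ∀ l → vsum l ≡ n →
             α l ≈ sign (entry0 l) * pow qinv n
                     * ΣV n q (λ i → sign (entry0 i) * γ i * conj (MG G l i)))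
         ×
         ((β : Vec ℕ q → Carrier) →
           (∀ x → vsum x ≡ n → γ x ≈ ΣV n q (λ s → β s * MG G s x)) →
           ∀ l → vsum l ≡ n →
             β l ≈ sign (entry0 l) * pow qinv n
                     * ΣV n q (λ i → sign (entry0 i) * γ i * conj (MG G i l))))
mainTheorem6 K (suc k) n _ qinv inv G hadamard γ =
    (λ symmetric →
       let inversion = twisted-inversion n qinv inv G hadamard trivial-sign trivial-character (symmetric⇒twisted symmetric) γ
       in (λ α expansion → drop-trivial-weight n γ (λ l i → conj (MG G l i)) (proj₁ inversion α expansion))
        , (λ β expansion → drop-trivial-weight n γ (λ l i → conj (MG G i l)) (proj₂ inversion β expansion)))
  , (λ core firstRow firstCol →
       twisted-inversion n qinv inv G hadamard firstSign-real sign-entry0-character (normalized⇒twisted core firstRow firstCol) γ)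
  where
  open InvolutiveCommRing K using (conj)
  open WithRing K using (MG)
  open Inversion K
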